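{- For integers $p',q',r'$ let $\min(p',q',r';|E|)$ denote the minimum of $|E(G)|$ over all connected finite simple graphs $G$ with $\mathrm{ind\text{ - }match}(G)=p'$, $\mathrm{min\text{ - }match}(G)=q'$ and $\mathrm{match}(G)=r'$. Let $p,q,r$ be integers with $2\le p<q\le r\le 2q$. Then: (1) $\min(p,q,q;|E|)\le (a_1^2+1)p+(2a_1+1)b_1$, where $a_1,b_1$ are the non-negative integers with $q=a_1p+b_1$ and $0\le b_1\le p-1$; (2) if $q<r\le 2q-p+1$, then $\min(p,q,r;|E|)\le a_2^2(p-1)+(2a_2+1)b_2+p+\binom{2(r-q)+1}{2}$, where $a_2,b_2$ are the non-negative integers with $2q-r=a_2(p-1)+b_2$ and $0\le b_2\le p-2$; (3) if $2q-p+1<r\le 2q$, then $\min(p,q,r;|E|)\le p+2q-r+(p-2q+r)\binom{2a_3+1}{2}+b_3(4a_3+3)$, where $a_3,b_3$ are the non-negative integers with $r-q=a_3(p-2q+r)+b_3$ and $0\le b_3\le p-2q+r-1$.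
   Context: All graphs are finite and simple. A matching of $G$ is a set of pairwise disjoint edges. A maximal matching is a matching not properly contained in another matching. An induced matching is a matching $M$ such that for distinct $e,f\in M$ there is no edge $g$ of $G$ meeting both $e$ and $f$. $\mathrm{match}(G)$ is the maximum size of a matching, $\mathrm{min\text{ - }match}(G)$ the minimum size of a maximal matching, and $\mathrm{ind\text{ - }match}(G)$ the maximum size of an induced matching of $G$. -}

module Defs where

open import Data.Nat using (ℕ; zero; suc; _+_; _≤_)
open import Data.Fin using (Fin; _<?_)
open import Data.Bool using (Bool; true; false; if_then_else_; _∧_)
open import Data.List using (List; map; allFin)
open import Data.Nat.ListAction using (sum)
open import Data.Product using (Σ; _×_; ∃; ∃-syntax)
open import Data.Sum using (_⊎_)
open import Relation.Nullary using (¬_; does)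
open import Relation.Binary.PropositionalEquality using (_≡_)

record Graph (n : ℕ) : Set where
  field
    adj    : Fin n → Fin n → Bool
    sym    : ∀ u v → adj u v ≡ adj v u
    irrefl : ∀ u → adj u u ≡ false
open Graph public

EdgeSet : ℕ → Set
EdgeSet n = Fin n → Fin n → Bool

edgeCount : ∀ {n} → EdgeSet n → ℕ
edgeCount {n} F =
  sum (map (λ u → sum (map (λ v → if does (u <? v) ∧ F u v then 1 else 0) (allFin n))) (allFin n))

numEdges : ∀ {n} → Graph n → ℕ
numEdges G = edgeCount (adj G)

data Reach {n : ℕ} (G : Graph n) : Fin n → Fin n → Set where
  here : ∀ {u} → Reach G u u
  step : ∀ {u v w} → adj G u v ≡ true → Reach G v w → Reach G u w

Connected : ∀ {n} → Graph n → Set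
Connected {n} G = ∀ (u v : Fin n) → Reach G u v

IsMatching : ∀ {n} → Graph n → EdgeSet n → Set
IsMatching {n} G M =
  (∀ u v → M u v ≡ true → adj G u v ≡ true) ×
  (∀ u v → M u v ≡ M v u) ×
  (∀ u v w → M u v ≡ true → M u w ≡ true → v ≡ w)

_⊆ₑ_ : ∀ {n} → EdgeSet n → EdgeSet n → Set
M ⊆ₑ M' = ∀ u v → M u v ≡ true → M' u v ≡ true

IsMaximalMatching : ∀ {n} → Graph n → EdgeSet n → Set
IsMaximalMatching {n} G M =
  IsMatching G M ×
  ¬ (Σ (EdgeSet n) λ M' → IsMatching G M' × M ⊆ₑ M' ×
       ∃[ u ] ∃[ v ] (M' u v ≡ true × M u v ≡ false))

Meets : ∀ {n} → Fin n → Fin n → Fin n → Fin n → Set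
Meets a b u v = (a ≡ u ⊎ a ≡ v) ⊎ (b ≡ u ⊎ b ≡ v)

IsInducedMatching : ∀ {n} → Graph n → EdgeSet n → Set
IsInducedMatching {n} G M =
  IsMatching G M ×
  (∀ u v x y → M u v ≡ true → M x y ≡ true →
     ¬ ((u ≡ x × v ≡ y) ⊎ (u ≡ y × v ≡ x)) →
     ∀ a b → adj G a b ≡ true → ¬ (Meets a b u v × Meets a b x y))

MatchNumber : ∀ {n} → Graph n → ℕ → Set
MatchNumber {n} G k =
  (Σ (EdgeSet n) λ M → IsMatching G M × edgeCount M ≡ k) ×
  (∀ M → IsMatching G M → edgeCount M ≤ k)

MinMatchNumber : ∀ {n} → Graph n → ℕ → Set
MinMatchNumber {n} G k =
  (Σ (EdgeSet n) λ M → IsMaximalMatching G M × edgeCount M ≡ k) ×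
  (∀ M → IsMaximalMatching G M → k ≤ edgeCount M)

IndMatchNumber : ∀ {n} → Graph n → ℕ → Set
IndMatchNumber {n} G k =
  (Σ (EdgeSet n) λ M → IsInducedMatching G M × edgeCount M ≡ k) ×
  (∀ M → IsInducedMatching G M → edgeCount M ≤ k)

MinEdgesAtMost : ℕ → ℕ → ℕ → ℕ → Set
MinEdgesAtMost p q r B =
  ∃[ n ] Σ (Graph n) λ G →
    Connected G × IndMatchNumber G p × MinMatchNumber G q × MatchNumber G r ×
    numEdges G ≤ B

{-# OPTIONS --safe #-}
-- Each bound is attained by a star: a centre joined by one edge to the root of each of p gadgets,
-- a gadget being K_{s,s} rooted on one side, or the corona of K_{2t} (a pendant vertex attached to
-- each clique vertex) rooted in the clique.  Within a gadget any two edges are met by a common edge,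
-- and the root is adjacent to an endpoint of every edge avoiding it, so an induced matching of the star
-- takes at most one edge per gadget (counting the edge to its root): ind-match = p.  The perfect
-- matchings of the gadgets leave only the centre uncovered: match = Σ s + Σ 2t.  The free vertices
-- of a maximal matching are independent; in K_{s,s} both sides keep equally many free vertices, so
-- none, and in a corona a free clique vertex would leave its pendant free, so at most the 2t
-- pendants are.  Beyond these only the centre, or the root it is matched into, can be free, whence
-- min-match = Σ s + Σ t.  The three divisions with remainder say how many K_{a,a}, K_{a+1,a+1} and
-- coronas to take.
module Submission where

open import Defs hiding (sym)
open import Algebra.Properties.CommutativeMonoid.Sum using ()
open import Data.Bool using (Bool; true; false; if_then_else_; _∧_; _∨_; not)
open import Data.Bool.Properties
  using (∨-comm; ∧-comm; ∨-zeroʳ; ∨-identityʳ; ∧-identityʳ; ∧-zeroʳ; ∧-conicalˡ; ∧-conicalʳ; ¬-not)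
open import Data.Empty using (⊥; ⊥-elim)
open import Data.Fin using (Fin; zero; suc; _↑ˡ_; _↑ʳ_; splitAt; _≟_; _<?_)
open import Data.Fin.Properties
  using (suc-injective; <-cmp; splitAt-↑ˡ; splitAt-↑ʳ; ↑ˡ-injective; ↑ʳ-injective)
open import Data.List using (List; []; _∷_; _++_; replicate)
import Data.List as List
open import Data.List.Properties using (map-tabulate)
import Data.Nat.ListAction as ListAction
open import Data.Nat using (ℕ; zero; suc; _+_; _*_; _∸_; _^_; _≤_; _<_; _≡ᵇ_; z≤n; s≤s)
open import Data.Nat.Combinatorics using (_C_; nC1≡n; nCk+nC[k+1]≡[n+1]C[k+1])
open import Data.Nat.Properties
  using ( +-comm; +-assoc; +-identityʳ; +-suc; *-identityʳ; *-zeroʳ; *-suc; *-distribˡ-+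
        ; +-cancelˡ-≡; +-cancelˡ-≤; +-cancelʳ-≤; +-cancelˡ-<; *-cancelˡ-≡; *-cancelˡ-≤; *-cancelˡ-<
        ; ≤-refl; ≤-trans; ≤-reflexive; ≤-pred; <-irrefl; <-≤-trans; <⇒≤; n≤1+n; m≤m+n; m≤n+m
        ; +-mono-≤; +-monoʳ-≤; m+n≤o⇒m≤o; n≤0⇒n≡0; m+n≡0⇒m≡0; 0≢1+n
        ; m+n∸n≡m; m+n∸m≡n; [m+n]∸[m+o]≡n∸o; m≤n⇒∃[o]m+o≡n
        ; +-0-commutativeMonoid; module ≤-Reasoning )
open import Data.Nat.Tactic.RingSolver using (solve-∀)
open import Data.Product using (Σ; _×_; _,_; proj₁; proj₂; ∃; ∃-syntax; ∃₂)
import Data.Product as Product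
open import Data.Sum using (_⊎_; inj₁; inj₂)
import Data.Sum as Sum
open import Function.Base using (_∘_)
open import Function.Definitions using (Injective)
open import Relation.Binary using (tri<; tri≈; tri>)
open import Relation.Binary.PropositionalEquality
  using (_≡_; _≢_; refl; sym; trans; cong; cong₂; subst; subst₂; module ≡-Reasoning)
open import Relation.Nullary using (¬_; does; yes; no)
open import Relation.Nullary.Decidable using (Dec; dec-true; dec-false; _×-dec_; _⊎-dec_; decidable-stable)

open Algebra.Properties.CommutativeMonoid.Sum +-0-commutativeMonoid
  using (sum; sum-syntax; sum-cong-≗; ∑-distrib-+; ∑-comm)

⟦_⟧ : Bool → ℕ
⟦ b ⟧ = if b then 1 else 0

⟦⟧≤1 : ∀ b → ⟦ b ⟧ ≤ 1
⟦⟧≤1 true  = s≤s z≤n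
⟦⟧≤1 false = z≤n

⟦⟧>0⇒true : ∀ {b} → 0 < ⟦ b ⟧ → b ≡ true
⟦⟧>0⇒true {true} _ = refl

true≢false : true ≢ false
true≢false ()

∧-true : ∀ {a b} → a ∧ b ≡ true → a ≡ true × b ≡ true
∧-true {a} {b} e = ∧-conicalˡ a b e , ∧-conicalʳ a b e

∨-true : ∀ {a b} → a ∨ b ≡ true → a ≡ true ⊎ b ≡ true
∨-true {true}  _ = inj₁ refl
∨-true {false} e = inj₂ e

infix 7 _==_

_==_ : ∀ {n} → Fin n → Fin n → Bool
i == j = does (i ≟ j)

==-refl : ∀ {n} (i : Fin n) → (i == i) ≡ true
==-refl i = dec-true (i ≟ i) refl

≢⇒==false : ∀ {n} {i j : Fin n} → i ≢ j → (i == j) ≡ false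
≢⇒==false {i = i} {j} = dec-false (i ≟ j)

==⇒≡ : ∀ {n} {i j : Fin n} → (i == j) ≡ true → i ≡ j
==⇒≡ {i = i} {j} e with i ≟ j
... | yes i≡j = i≡j

==-sym : ∀ {n} (i j : Fin n) → (i == j) ≡ (j == i)
==-sym i j with i ≟ j
... | yes refl = sym (==-refl i)
... | no i≢j   = sym (≢⇒==false (λ j≡i → i≢j (sym j≡i)))

-- Finite sums and degree sums

∑-const : ∀ n k → ∑[ i < n ] k ≡ n * k
∑-const zero    k = refl
∑-const (suc n) k = cong (k +_) (∑-const n k)

∑-zero : ∀ {n} {f : Fin n → ℕ} → (∀ i → f i ≡ 0) → sum f ≡ 0
∑-zero {n} f≡0 = trans (sum-cong-≗ f≡0) (trans (∑-const n 0) (*-zeroʳ n))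

∑-mono : ∀ {n} {f g : Fin n → ℕ} → (∀ i → f i ≤ g i) → sum f ≤ sum g
∑-mono {zero}  f≤g = z≤n
∑-mono {suc n} f≤g = +-mono-≤ (f≤g zero) (∑-mono (λ i → f≤g (suc i)))

∑-++ : ∀ {n h} (f : Fin (n + h) → ℕ) → sum f ≡ ∑[ i < n ] f (i ↑ˡ h) + ∑[ j < h ] f (n ↑ʳ j)
∑-++ {zero}      f = refl
∑-++ {suc n} {h} f = trans (cong (f zero +_) (∑-++ {n} {h} (λ i → f (suc i)))) (sym (+-assoc (f zero) _ _))

∑-single : ∀ {n} {f : Fin n → ℕ} (c : Fin n) → (∀ i → i ≢ c → f i ≡ 0) → sum f ≡ f c
∑-single {suc n} {f} zero    others≡0 =
  trans (cong (f zero +_) (∑-zero (λ i → others≡0 (suc i) λ ()))) (+-identityʳ _)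
∑-single {suc n} {f} (suc c) others≡0 =
  trans (cong (_+ ∑[ i < n ] f (suc i)) (others≡0 zero λ ()))
        (∑-single {f = λ i → f (suc i)} c (λ i i≢c → others≡0 (suc i) (λ e → i≢c (suc-injective e))))

∑>0⇒∃ : ∀ {n} (f : Fin n → ℕ) → 0 < sum f → ∃[ i ] 0 < f i
∑>0⇒∃ {suc n} f ∑>0 with f zero in eq
... | suc _ = zero , subst (0 <_) (sym eq) (s≤s z≤n)
... | zero  with ∑>0⇒∃ (λ i → f (suc i)) ∑>0
...   | i , fi>0 = suc i , fi>0

term≤∑ : ∀ {n} (f : Fin n → ℕ) i → f i ≤ sum f
term≤∑ f zero    = m≤m+n _ _
term≤∑ f (suc i) = ≤-trans (term≤∑ (λ i → f (suc i)) i) (m≤n+m _ _)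

∑-==ˡ : ∀ {n} (i : Fin n) → ∑[ j < n ] ⟦ i == j ⟧ ≡ 1
∑-==ˡ i = trans (∑-single i (λ j j≢i → cong ⟦_⟧ (≢⇒==false (λ i≡j → j≢i (sym i≡j)))))
                (cong ⟦_⟧ (==-refl i))

∑-==ʳ : ∀ {n} (j : Fin n) → ∑[ i < n ] ⟦ i == j ⟧ ≡ 1
∑-==ʳ j = trans (∑-single j (λ i i≢j → cong ⟦_⟧ (≢⇒==false i≢j))) (cong ⟦_⟧ (==-refl j))

∑∑-point : ∀ {n h} (c : Fin n) (x : Fin h) → ∑[ i < n ] ∑[ j < h ] ⟦ i == c ∧ j == x ⟧ ≡ 1
∑∑-point {n} {h} c x = begin
  ∑[ i < n ] ∑[ j < h ] ⟦ i == c ∧ j == x ⟧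
    ≡⟨ ∑-single c (λ i i≢c → ∑-zero {h} λ j → cong (λ t → ⟦ t ∧ j == x ⟧) (≢⇒==false i≢c)) ⟩
  ∑[ j < h ] ⟦ c == c ∧ j == x ⟧
    ≡⟨ sum-cong-≗ (λ j → cong (λ t → ⟦ t ∧ j == x ⟧) (==-refl c)) ⟩
  ∑[ j < h ] ⟦ j == x ⟧
    ≡⟨ ∑-==ʳ x ⟩
  1 ∎
  where open ≡-Reasoning

∑⟦⟧>0⇒∃ : ∀ {n} (P : Fin n → Bool) → 0 < ∑[ i < n ] ⟦ P i ⟧ → ∃[ i ] P i ≡ true
∑⟦⟧>0⇒∃ P ∑>0 = let i , Pi>0 = ∑>0⇒∃ (λ i → ⟦ P i ⟧) ∑>0 in i , ⟦⟧>0⇒true Pi>0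

∑-unique≤1 : ∀ {n} (P : Fin n → Bool) → (∀ i j → P i ≡ true → P j ≡ true → i ≡ j) →
             ∑[ i < n ] ⟦ P i ⟧ ≤ 1
∑-unique≤1 {n} P unique with ∑[ i < n ] ⟦ P i ⟧ in eq
... | zero  = z≤n
... | suc _ with ∑⟦⟧>0⇒∃ P (subst (0 <_) (sym eq) (s≤s z≤n))
...   | i , Pi = subst (_≤ 1) (trans (sym (∑-single i others)) eq) (⟦⟧≤1 (P i))
  where
  others : ∀ j → j ≢ i → ⟦ P j ⟧ ≡ 0
  others j j≢i = cong ⟦_⟧ (¬-not λ Pj → j≢i (unique j i Pj Pi))

degree : ∀ {n} → EdgeSet n → Fin n → ℕ
degree {n} F u = ∑[ v < n ] ⟦ F u v ⟧

degreeSum : ∀ {n} → EdgeSet n → ℕ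
degreeSum {n} F = ∑[ u < n ] degree F u

listSum-allFin : ∀ {n} (f : Fin n → ℕ) → ListAction.sum (List.map f (List.allFin n)) ≡ sum f
listSum-allFin {n} f = trans (cong ListAction.sum (map-tabulate (λ i → i) f)) (sum-tabulate f)
  where
  sum-tabulate : ∀ {n} (f : Fin n → ℕ) → ListAction.sum (List.tabulate f) ≡ sum f
  sum-tabulate {zero}  f = refl
  sum-tabulate {suc n} f = cong (f zero +_) (sum-tabulate (λ i → f (suc i)))

forward : ∀ {n} → EdgeSet n → Fin n → Fin n → ℕ
forward F u v = ⟦ does (u <? v) ∧ F u v ⟧

edgeCount≡∑forward : ∀ {n} (F : EdgeSet n) → edgeCount F ≡ ∑[ u < n ] ∑[ v < n ] forward F u v
edgeCount≡∑forward {n} F =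
  trans (listSum-allFin {n} _) (sum-cong-≗ (λ u → listSum-allFin (forward F u)))

module _ {n} (F : EdgeSet n) (symmetric : ∀ u v → F u v ≡ F v u) (irreflexive : ∀ u → F u u ≡ false) where

  edge≡forward+backward : ∀ u v → ⟦ F u v ⟧ ≡ forward F u v + forward F v u
  edge≡forward+backward u v with <-cmp u v
  ... | tri< u<v _ v≮u
    rewrite dec-true (u <? v) u<v | dec-false (v <? u) v≮u = sym (+-identityʳ _)
  ... | tri> u≮v _ v<u
    rewrite dec-false (u <? v) u≮v | dec-true (v <? u) v<u = cong ⟦_⟧ (symmetric u v)
  ... | tri≈ u≮u refl _
    rewrite dec-false (u <? u) u≮u = cong ⟦_⟧ (irreflexive u)

  handshake : degreeSum F ≡ 2 * edgeCount F
  handshake = begin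
    degreeSum F
      ≡⟨ sum-cong-≗ (λ u → sum-cong-≗ (edge≡forward+backward u)) ⟩
    ∑[ u < n ] ∑[ v < n ] (forward F u v + forward F v u)
      ≡⟨ sum-cong-≗ (λ u → ∑-distrib-+ (forward F u) (λ v → forward F v u)) ⟩
    ∑[ u < n ] (∑[ v < n ] forward F u v + ∑[ v < n ] forward F v u)
      ≡⟨ ∑-distrib-+ (λ u → ∑[ v < n ] forward F u v) (λ u → ∑[ v < n ] forward F v u) ⟩
    E + ∑[ u < n ] ∑[ v < n ] forward F v u
      ≡⟨ cong (E +_) (∑-comm (λ u v → forward F v u)) ⟩
    E + E
      ≡⟨ cong (E +_) (sym (+-identityʳ E)) ⟩
    2 * E
      ≡⟨ cong (2 *_) (sym (edgeCount≡∑forward F)) ⟩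
    2 * edgeCount F ∎
    where
    open ≡-Reasoning
    E = ∑[ u < n ] ∑[ v < n ] forward F u v


-- Matchings

unmatched : ∀ {n} → EdgeSet n → Fin n → Bool
unmatched M u = degree M u ≡ᵇ 0

edge⇒degree>0 : ∀ {n} (M : EdgeSet n) u v → M u v ≡ true → 0 < degree M u
edge⇒degree>0 M u v Muv = subst (λ b → ⟦ b ⟧ ≤ degree M u) Muv (term≤∑ (λ v → ⟦ M u v ⟧) v)

edge⇒matched : ∀ {n} (M : EdgeSet n) u v → M u v ≡ true → unmatched M u ≡ false
edge⇒matched M u v Muv with degree M u | edge⇒degree>0 M u v Muv
... | suc _ | _ = refl

unmatched⇒noEdge : ∀ {n} (M : EdgeSet n) u v → unmatched M u ≡ true → M u v ≡ false
unmatched⇒noEdge M u v u-free = ¬-not λ Muv → true≢false (trans (sym u-free) (edge⇒matched M u v Muv))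

unmatched⊎edge : ∀ {n} (M : EdgeSet n) u → unmatched M u ≡ true ⊎ ∃[ v ] M u v ≡ true
unmatched⊎edge M u with degree M u in eq
... | zero  = inj₁ refl
... | suc _ = inj₂ (∑⟦⟧>0⇒∃ (M u) (subst (0 <_) (sym eq) (s≤s z≤n)))

SameEdge : ∀ {n} → Fin n → Fin n → Fin n → Fin n → Set
SameEdge u v x y = (u ≡ x × v ≡ y) ⊎ (u ≡ y × v ≡ x)

SameEdge-endpointˡ : ∀ {n} {u v p q : Fin n} → SameEdge u v p q → p ≡ u ⊎ p ≡ v
SameEdge-endpointˡ (inj₁ (refl , refl)) = inj₁ refl
SameEdge-endpointˡ (inj₂ (refl , refl)) = inj₂ refl

SameEdge-endpointʳ : ∀ {n} {u v p q : Fin n} → SameEdge u v p q → q ≡ u ⊎ q ≡ v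
SameEdge-endpointʳ (inj₁ (refl , refl)) = inj₂ refl
SameEdge-endpointʳ (inj₂ (refl , refl)) = inj₁ refl

UnmatchedIndependent : ∀ {n} → Graph n → EdgeSet n → Set
UnmatchedIndependent G M = ∀ a b → adj G a b ≡ true → unmatched M a ≡ true → unmatched M b ≡ true → ⊥

module Matching {n} (G : Graph n) (M : EdgeSet n) (m : IsMatching G M) where

  ⊆adj : ∀ u v → M u v ≡ true → adj G u v ≡ true
  ⊆adj = proj₁ m

  symmetric : ∀ u v → M u v ≡ M v u
  symmetric = proj₁ (proj₂ m)

  functional : ∀ u v w → M u v ≡ true → M u w ≡ true → v ≡ w
  functional = proj₂ (proj₂ m)

  nonAdjacent⇒false : ∀ u v → adj G u v ≡ false → M u v ≡ false
  nonAdjacent⇒false u v ¬uv = ¬-not λ Muv → true≢false (trans (sym (⊆adj u v Muv)) ¬uv)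

  irreflexive : ∀ u → M u u ≡ false
  irreflexive u = nonAdjacent⇒false u u (irrefl G u)

  degreeSum≡2*edgeCount : degreeSum M ≡ 2 * edgeCount M
  degreeSum≡2*edgeCount = handshake M symmetric irreflexive

  degree≤1 : ∀ u → degree M u ≤ 1
  degree≤1 u = ∑-unique≤1 (M u) (functional u)

  degree+unmatched≡1 : ∀ u → degree M u + ⟦ unmatched M u ⟧ ≡ 1
  degree+unmatched≡1 u with degree M u | degree≤1 u
  ... | zero     | _         = refl
  ... | suc zero | _         = refl
  ... | suc (suc _) | s≤s ()

  degreeSum+unmatched≡n : degreeSum M + ∑[ u < n ] ⟦ unmatched M u ⟧ ≡ n
  degreeSum+unmatched≡n = begin
    degreeSum M + ∑[ u < n ] ⟦ unmatched M u ⟧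
      ≡⟨ ∑-distrib-+ (degree M) (λ u → ⟦ unmatched M u ⟧) ⟨
    ∑[ u < n ] (degree M u + ⟦ unmatched M u ⟧)
      ≡⟨ sum-cong-≗ degree+unmatched≡1 ⟩
    ∑[ u < n ] 1
      ≡⟨ trans (∑-const n 1) (*-identityʳ n) ⟩
    n ∎
    where open ≡-Reasoning

  sharedVertex⇒same : ∀ {u v x y} → M u v ≡ true → M x y ≡ true →
                      ∀ z → (z ≡ u ⊎ z ≡ v) → (z ≡ x ⊎ z ≡ y) → SameEdge u v x y
  sharedVertex⇒same Muv Mxy z (inj₁ refl) (inj₁ refl) =
    inj₁ (refl , functional _ _ _ Muv Mxy)
  sharedVertex⇒same Muv Mxy z (inj₁ refl) (inj₂ refl) =
    inj₂ (refl , functional _ _ _ Muv (trans (symmetric _ _) Mxy))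
  sharedVertex⇒same Muv Mxy z (inj₂ refl) (inj₁ refl) =
    inj₂ (functional _ _ _ (trans (symmetric _ _) Muv) Mxy , refl)
  sharedVertex⇒same Muv Mxy z (inj₂ refl) (inj₂ refl) =
    inj₁ (functional _ _ _ (trans (symmetric _ _) Muv) (trans (symmetric _ _) Mxy) , refl)

emptyEdges : ∀ {n} → EdgeSet n
emptyEdges _ _ = false

empty-matching : ∀ {n} (G : Graph n) → IsMatching G emptyEdges
empty-matching G = (λ _ _ ()) , (λ _ _ → refl) , (λ _ _ _ ())

empty-induced : ∀ {n} (G : Graph n) → IsInducedMatching G emptyEdges
empty-induced G = empty-matching G , λ _ _ _ _ ()

degree-empty : ∀ {n} (u : Fin n) → degree emptyEdges u ≡ 0
degree-empty {n} u = ∑-zero {n} (λ _ → refl)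

degreeSum-empty : ∀ {n} → degreeSum (emptyEdges {n}) ≡ 0
degreeSum-empty {n} = ∑-zero {n} degree-empty

singleEdge : ∀ {n} → Fin n → Fin n → EdgeSet n
singleEdge a b u v = (u == a ∧ v == b) ∨ (u == b ∧ v == a)

module SingleEdge {n} (a b : Fin n) where

  ⇒same : ∀ {u v} → singleEdge a b u v ≡ true → SameEdge u v a b
  ⇒same {u} {v} e with ∨-true {u == a ∧ v == b} e
  ... | inj₁ e′ = let u≡a , v≡b = ∧-true {u == a} e′ in inj₁ (==⇒≡ u≡a , ==⇒≡ v≡b)
  ... | inj₂ e′ = let u≡b , v≡a = ∧-true {u == b} e′ in inj₂ (==⇒≡ u≡b , ==⇒≡ v≡a)

  symmetric : ∀ u v → singleEdge a b u v ≡ singleEdge a b v u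
  symmetric u v = trans (∨-comm (u == a ∧ v == b) _)
    (cong₂ _∨_ (∧-comm (u == b) (v == a)) (∧-comm (u == a) (v == b)))

  endpoints : singleEdge a b a b ≡ true
  endpoints rewrite ==-refl a | ==-refl b = refl

  ⇒adj : ∀ (G : Graph n) → adj G a b ≡ true → ∀ u v → singleEdge a b u v ≡ true → adj G u v ≡ true
  ⇒adj G ab u v e with ⇒same {u} {v} e
  ... | inj₁ (refl , refl) = ab
  ... | inj₂ (refl , refl) = trans (Graph.sym G b a) ab

adj⇒≢ : ∀ {n} (G : Graph n) {a b} → adj G a b ≡ true → a ≢ b
adj⇒≢ G {a} ab refl = true≢false (trans (sym ab) (irrefl G a))

∪-matching : ∀ {n} {G : Graph n} {M N : EdgeSet n} → IsMatching G M → IsMatching G N →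
             (∀ u v w → M u v ≡ true → N u w ≡ true → ⊥) → IsMatching G (λ u v → M u v ∨ N u v)
∪-matching {G = G} {M} {N} m n disjoint = ⊆adj , symmetric , functional
  where
  module M = Matching G M m
  module N = Matching G N n
  ⊆adj : ∀ u v → (M u v ∨ N u v) ≡ true → _
  ⊆adj u v e with ∨-true {M u v} e
  ... | inj₁ Muv = M.⊆adj u v Muv
  ... | inj₂ Nuv = N.⊆adj u v Nuv
  symmetric : ∀ u v → (M u v ∨ N u v) ≡ (M v u ∨ N v u)
  symmetric u v = cong₂ _∨_ (M.symmetric u v) (N.symmetric u v)
  functional : ∀ u v w → (M u v ∨ N u v) ≡ true → (M u w ∨ N u w) ≡ true → v ≡ w
  functional u v w e e′ with ∨-true {M u v} e | ∨-true {M u w} e′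
  ... | inj₁ Muv | inj₁ Muw = M.functional u v w Muv Muw
  ... | inj₁ Muv | inj₂ Nuw = ⊥-elim (disjoint u v w Muv Nuw)
  ... | inj₂ Nuv | inj₁ Muw = ⊥-elim (disjoint u w v Muw Nuv)
  ... | inj₂ Nuv | inj₂ Nuw = N.functional u v w Nuv Nuw

module _ {n} (G : Graph n) {a b : Fin n} (ab : adj G a b ≡ true) where

  singleEdge-matching : IsMatching G (singleEdge a b)
  singleEdge-matching = SingleEdge.⇒adj a b G ab , SingleEdge.symmetric a b , functional
    where
    functional : ∀ u v w → singleEdge a b u v ≡ true → singleEdge a b u w ≡ true → v ≡ w
    functional u v w e e′ with SingleEdge.⇒same a b {u} {v} e | SingleEdge.⇒same a b {u} {w} e′
    ... | inj₁ (_ , refl)    | inj₁ (_ , refl) = refl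
    ... | inj₂ (_ , refl)    | inj₂ (_ , refl) = refl
    ... | inj₁ (refl , _)    | inj₂ (a≡b , _)  = ⊥-elim (adj⇒≢ G ab a≡b)
    ... | inj₂ (refl , _)    | inj₁ (b≡a , _)  = ⊥-elim (adj⇒≢ G ab (sym b≡a))

  singleEdge-induced : IsInducedMatching G (singleEdge a b)
  singleEdge-induced = singleEdge-matching , λ u v x y e e′ distinct _ _ _ _ →
    distinct (same (SingleEdge.⇒same a b {u} {v} e) (SingleEdge.⇒same a b {x} {y} e′))
    where
    same : ∀ {u v x y} → SameEdge u v a b → SameEdge x y a b → SameEdge u v x y
    same (inj₁ (refl , refl)) (inj₁ (refl , refl)) = inj₁ (refl , refl)
    same (inj₁ (refl , refl)) (inj₂ (refl , refl)) = inj₂ (refl , refl)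
    same (inj₂ (refl , refl)) (inj₁ (refl , refl)) = inj₂ (refl , refl)
    same (inj₂ (refl , refl)) (inj₂ (refl , refl)) = inj₁ (refl , refl)

  degreeSum-singleEdge : degreeSum (singleEdge a b) ≡ 2
  degreeSum-singleEdge = begin
    ∑[ u < n ] ∑[ v < n ] ⟦ singleEdge a b u v ⟧
      ≡⟨ sum-cong-≗ (λ u → sum-cong-≗ (disjointCases u)) ⟩
    ∑[ u < n ] ∑[ v < n ] (⟦ u == a ∧ v == b ⟧ + ⟦ u == b ∧ v == a ⟧)
      ≡⟨ sum-cong-≗ (λ u → ∑-distrib-+ (λ v → ⟦ u == a ∧ v == b ⟧) _) ⟩
    ∑[ u < n ] (∑[ v < n ] ⟦ u == a ∧ v == b ⟧ + ∑[ v < n ] ⟦ u == b ∧ v == a ⟧)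
      ≡⟨ ∑-distrib-+ (λ u → ∑[ v < n ] ⟦ u == a ∧ v == b ⟧) _ ⟩
    ∑[ u < n ] ∑[ v < n ] ⟦ u == a ∧ v == b ⟧ + ∑[ u < n ] ∑[ v < n ] ⟦ u == b ∧ v == a ⟧
      ≡⟨ cong₂ _+_ (∑∑-point a b) (∑∑-point b a) ⟩
    2 ∎
    where
    open ≡-Reasoning
    disjointCases : ∀ u v → ⟦ singleEdge a b u v ⟧ ≡ ⟦ u == a ∧ v == b ⟧ + ⟦ u == b ∧ v == a ⟧
    disjointCases u v with u == a in ua | u == b in ub
    ... | true  | true  = ⊥-elim (adj⇒≢ G ab (trans (sym (==⇒≡ {i = u} ua)) (==⇒≡ {i = u} ub)))
    ... | true  | false = trans (cong ⟦_⟧ (∨-identityʳ (v == b))) (sym (+-identityʳ _))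
    ... | false | true  = refl
    ... | false | false = refl

module _ {n} {G : Graph n} {M : EdgeSet n} where

  unmatchedIndependent⇒maximal : IsMatching G M → UnmatchedIndependent G M → IsMaximalMatching G M
  unmatchedIndependent⇒maximal m independent = m , λ (M′ , m′ , M⊆M′ , u , v , M′uv , Muv) →
    noNewEdge M′ m′ M⊆M′ u v M′uv Muv
    where
    module M = Matching G M m
    noNewEdge : ∀ M′ → IsMatching G M′ → M ⊆ₑ M′ →
                ∀ u v → M′ u v ≡ true → M u v ≡ false → ⊥
    noNewEdge M′ m′ M⊆M′ u v M′uv Muv with unmatched⊎edge M u | unmatched⊎edge M v
    ... | inj₂ (w , Muw) | _ with Matching.functional G M′ m′ u v w M′uv (M⊆M′ u w Muw)
    ...   | refl = true≢false (trans (sym Muw) Muv)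
    noNewEdge M′ m′ M⊆M′ u v M′uv Muv | inj₁ _ | inj₂ (w , Mvw)
      with Matching.functional G M′ m′ v u w (trans (Matching.symmetric G M′ m′ v u) M′uv) (M⊆M′ v w Mvw)
    ...   | refl = true≢false (trans (sym Mvw) (trans (M.symmetric v u) Muv))
    noNewEdge M′ m′ M⊆M′ u v M′uv Muv | inj₁ u-free | inj₁ v-free =
      independent u v (Matching.⊆adj G M′ m′ u v M′uv) u-free v-free

  maximal⇒unmatchedIndependent : IsMaximalMatching G M → UnmatchedIndependent G M
  maximal⇒unmatchedIndependent (m , maximal) a b ab a-free b-free =
    maximal ((λ u v → M u v ∨ singleEdge a b u v) , ∪-matching {G = G} m (singleEdge-matching G ab) disjoint ,
             (λ u v Muv → cong (_∨ singleEdge a b u v) Muv) ,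
             a , b , trans (cong (M a b ∨_) (SingleEdge.endpoints a b)) (∨-zeroʳ (M a b)) ,
             unmatched⇒noEdge M a b a-free)
    where
    disjoint : ∀ u v w → M u v ≡ true → singleEdge a b u w ≡ true → ⊥
    disjoint u v w Muv e with SingleEdge.⇒same a b {u} {w} e
    ... | inj₁ (refl , _) = true≢false (trans (sym Muv) (unmatched⇒noEdge M a v a-free))
    ... | inj₂ (refl , _) = true≢false (trans (sym Muv) (unmatched⇒noEdge M b v b-free))

reach-trans : ∀ {n} {G : Graph n} {u v w} → Reach G u v → Reach G v w → Reach G u w
reach-trans here          q = q
reach-trans (step uv r) q = step uv (reach-trans r q)

reach-sym : ∀ {n} {G : Graph n} {u v} → Reach G u v → Reach G v u
reach-sym here                          = here
reach-sym {G = G} (step {u} {v} uv r) = reach-trans (reach-sym r) (step (trans (Graph.sym G v u) uv) here)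

reach-map : ∀ {n k} {G : Graph n} {K : Graph k} (f : Fin n → Fin k) →
            (∀ a b → adj G a b ≡ true → adj K (f a) (f b) ≡ true) →
            ∀ {u v} → Reach G u v → Reach K (f u) (f v)
reach-map f hom here        = here
reach-map f hom (step uv r) = step (hom _ _ uv) (reach-map f hom r)

connected-via : ∀ {n} {G : Graph n} (x : Fin n) → (∀ u → Reach G u x) → Connected G
connected-via x toX u v = reach-trans (toX u) (reach-sym (toX v))

-- Two graphs side by side

data Side (n h : ℕ) : Fin (n + h) → Set where
  left  : (i : Fin n) → Side n h (i ↑ˡ h)
  right : (j : Fin h) → Side n h (n ↑ʳ j)

side : ∀ n h (u : Fin (n + h)) → Side n h u
side zero    h u       = right u
side (suc n) h zero    = left zero
side (suc n) h (suc u) with side n h u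
... | left i  = left (suc i)
... | right j = right j

↑ˡ≢↑ʳ : ∀ {n h} (i : Fin n) (j : Fin h) → i ↑ˡ h ≢ n ↑ʳ j
↑ˡ≢↑ʳ zero    j ()
↑ˡ≢↑ʳ (suc i) j e = ↑ˡ≢↑ʳ i j (suc-injective e)

↑ˡ-Injective : ∀ {n} h → Injective _≡_ _≡_ (λ (i : Fin n) → i ↑ˡ h)
↑ˡ-Injective h = ↑ˡ-injective h _ _

↑ʳ-Injective : ∀ n {h} → Injective _≡_ _≡_ (λ (j : Fin h) → n ↑ʳ j)
↑ʳ-Injective n = ↑ʳ-injective n _ _

-- F on the first n vertices, G on the last h, and B i j for the edge between i ↑ˡ h and n ↑ʳ j.
combine : ∀ {n h} → EdgeSet n → EdgeSet h → (Fin n → Fin h → Bool) → EdgeSet (n + h)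
combine {n} F G B u v = combine′ (splitAt n u) (splitAt n v)
  where
  combine′ : _ ⊎ _ → _ ⊎ _ → Bool
  combine′ (inj₁ i) (inj₁ j) = F i j
  combine′ (inj₁ i) (inj₂ j) = B i j
  combine′ (inj₂ i) (inj₁ j) = B j i
  combine′ (inj₂ i) (inj₂ j) = G i j

module _ {n h : ℕ} (F : EdgeSet n) (G : EdgeSet h) (B : Fin n → Fin h → Bool) where

  combine-ˡˡ : ∀ i j → combine F G B (i ↑ˡ h) (j ↑ˡ h) ≡ F i j
  combine-ˡˡ i j rewrite splitAt-↑ˡ n i h | splitAt-↑ˡ n j h = refl

  combine-ˡʳ : ∀ i j → combine F G B (i ↑ˡ h) (n ↑ʳ j) ≡ B i j
  combine-ˡʳ i j rewrite splitAt-↑ˡ n i h | splitAt-↑ʳ n h j = refl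

  combine-ʳˡ : ∀ i j → combine F G B (n ↑ʳ i) (j ↑ˡ h) ≡ B j i
  combine-ʳˡ i j rewrite splitAt-↑ʳ n h i | splitAt-↑ˡ n j h = refl

  combine-ʳʳ : ∀ i j → combine F G B (n ↑ʳ i) (n ↑ʳ j) ≡ G i j
  combine-ʳʳ i j rewrite splitAt-↑ʳ n h i | splitAt-↑ʳ n h j = refl

  combine-symmetric : (∀ i j → F i j ≡ F j i) → (∀ i j → G i j ≡ G j i) →
                      ∀ u v → combine F G B u v ≡ combine F G B v u
  combine-symmetric F-sym G-sym u v with side n h u | side n h v
  ... | left i  | left j  rewrite combine-ˡˡ i j | combine-ˡˡ j i = F-sym i j
  ... | left i  | right j rewrite combine-ˡʳ i j | combine-ʳˡ j i = refl
  ... | right i | left j  rewrite combine-ʳˡ i j | combine-ˡʳ j i = refl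
  ... | right i | right j rewrite combine-ʳʳ i j | combine-ʳʳ j i = G-sym i j

  combine-irreflexive : (∀ i → F i i ≡ false) → (∀ i → G i i ≡ false) →
                        ∀ u → combine F G B u u ≡ false
  combine-irreflexive F-irr G-irr u with side n h u
  ... | left i  rewrite combine-ˡˡ i i = F-irr i
  ... | right i rewrite combine-ʳʳ i i = G-irr i

combineGraph : ∀ {n h} → Graph n → Graph h → (Fin n → Fin h → Bool) → Graph (n + h)
combineGraph G H B = record
  { adj    = combine (adj G) (adj H) B
  ; sym    = combine-symmetric (adj G) (adj H) B (Graph.sym G) (Graph.sym H)
  ; irrefl = combine-irreflexive (adj G) (adj H) B (irrefl G) (irrefl H)
  }

module Restrict {n h : ℕ} (F : EdgeSet (n + h)) where

  restrictˡ : EdgeSet n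
  restrictˡ i j = F (i ↑ˡ h) (j ↑ˡ h)

  restrictʳ : EdgeSet h
  restrictʳ i j = F (n ↑ʳ i) (n ↑ʳ j)

  between : Fin n → Fin h → Bool
  between i j = F (i ↑ˡ h) (n ↑ʳ j)

  crossing : ℕ
  crossing = ∑[ i < n ] ∑[ j < h ] ⟦ between i j ⟧

  degreeˡ : ∀ i → degree F (i ↑ˡ h) ≡ degree restrictˡ i + ∑[ j < h ] ⟦ between i j ⟧
  degreeˡ i = ∑-++ {n} {h} (λ v → ⟦ F (i ↑ˡ h) v ⟧)

  module _ (F-sym : ∀ u v → F u v ≡ F v u) where

    degreeʳ : ∀ j → degree F (n ↑ʳ j) ≡ ∑[ i < n ] ⟦ between i j ⟧ + degree restrictʳ j
    degreeʳ j = trans (∑-++ {n} {h} (λ v → ⟦ F (n ↑ʳ j) v ⟧))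
                      (cong (_+ degree restrictʳ j)
                            (sum-cong-≗ (λ i → cong ⟦_⟧ (F-sym (n ↑ʳ j) (i ↑ˡ h)))))

    degreeSum-split : degreeSum F ≡ degreeSum restrictˡ + degreeSum restrictʳ + 2 * crossing
    degreeSum-split = begin
      degreeSum F
        ≡⟨ ∑-++ {n} {h} (degree F) ⟩
      ∑[ i < n ] degree F (i ↑ˡ h) + ∑[ j < h ] degree F (n ↑ʳ j)
        ≡⟨ cong₂ _+_ (sum-cong-≗ degreeˡ) (sum-cong-≗ degreeʳ) ⟩
      ∑[ i < n ] (degree restrictˡ i + ∑[ j < h ] ⟦ between i j ⟧) +
      ∑[ j < h ] (∑[ i < n ] ⟦ between i j ⟧ + degree restrictʳ j)
        ≡⟨ cong₂ _+_ (∑-distrib-+ (degree restrictˡ) (λ i → ∑[ j < h ] ⟦ between i j ⟧))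
                     (∑-distrib-+ (λ j → ∑[ i < n ] ⟦ between i j ⟧) (degree restrictʳ)) ⟩
      (degreeSum restrictˡ + crossing) + (∑[ j < h ] ∑[ i < n ] ⟦ between i j ⟧ + degreeSum restrictʳ)
        ≡⟨ cong (λ t → (degreeSum restrictˡ + crossing) + (t + degreeSum restrictʳ))
                (sym (∑-comm (λ i j → ⟦ between i j ⟧))) ⟩
      (degreeSum restrictˡ + crossing) + (crossing + degreeSum restrictʳ)
        ≡⟨ rearrange (degreeSum restrictˡ) (degreeSum restrictʳ) crossing ⟩
      degreeSum restrictˡ + degreeSum restrictʳ + 2 * crossing ∎
      where
      open ≡-Reasoning
      rearrange : ∀ a b x → (a + x) + (x + b) ≡ a + b + 2 * x
      rearrange = solve-∀

open Restrict public

module _ {n h : ℕ} (F : EdgeSet n) (G : EdgeSet h) (B : Fin n → Fin h → Bool) where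

  degree-combineˡ : ∀ i → degree (combine F G B) (i ↑ˡ h) ≡ degree F i + ∑[ j < h ] ⟦ B i j ⟧
  degree-combineˡ i = trans (degreeˡ {n} {h} (combine F G B) i)
    (cong₂ _+_ (sum-cong-≗ (λ j → cong ⟦_⟧ (combine-ˡˡ F G B i j)))
               (sum-cong-≗ (λ j → cong ⟦_⟧ (combine-ˡʳ F G B i j))))

  module _ (F-sym : ∀ i j → F i j ≡ F j i) (G-sym : ∀ i j → G i j ≡ G j i) where

    degree-combineʳ : ∀ j → degree (combine F G B) (n ↑ʳ j) ≡ ∑[ i < n ] ⟦ B i j ⟧ + degree G j
    degree-combineʳ j = trans (degreeʳ {n} {h} (combine F G B) (combine-symmetric F G B F-sym G-sym) j)
      (cong₂ _+_ (sum-cong-≗ (λ i → cong ⟦_⟧ (combine-ˡʳ F G B i j)))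
                 (sum-cong-≗ (λ i → cong ⟦_⟧ (combine-ʳʳ F G B j i))))

    degreeSum-combine :
      degreeSum (combine F G B) ≡ degreeSum F + degreeSum G + 2 * ∑[ i < n ] ∑[ j < h ] ⟦ B i j ⟧
    degreeSum-combine = trans (degreeSum-split {n} {h} (combine F G B) (combine-symmetric F G B F-sym G-sym))
      (cong₂ _+_ (cong₂ _+_ (sum-cong-≗ (λ i → sum-cong-≗ (λ j → cong ⟦_⟧ (combine-ˡˡ F G B i j))))
                             (sum-cong-≗ (λ i → sum-cong-≗ (λ j → cong ⟦_⟧ (combine-ʳʳ F G B i j)))))
                 (cong (2 *_) (sum-cong-≗ (λ i → sum-cong-≗ (λ j → cong ⟦_⟧ (combine-ˡʳ F G B i j))))))

Meets-map : ∀ {n k} (f : Fin n → Fin k) {a b u v} → Meets a b u v → Meets (f a) (f b) (f u) (f v)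
Meets-map f = Sum.map (Sum.map (cong f) (cong f)) (Sum.map (cong f) (cong f))

Meets-unmap : ∀ {n k} {f : Fin n → Fin k} → Injective _≡_ _≡_ f →
              ∀ {a b u v} → Meets (f a) (f b) (f u) (f v) → Meets a b u v
Meets-unmap inj = Sum.map (Sum.map inj inj) (Sum.map inj inj)

SameEdge-map : ∀ {n k} (f : Fin n → Fin k) {u v x y} → SameEdge u v x y → SameEdge (f u) (f v) (f x) (f y)
SameEdge-map f = Sum.map (Product.map (cong f) (cong f)) (Product.map (cong f) (cong f))

SameEdge-unmap : ∀ {n k} {f : Fin n → Fin k} → Injective _≡_ _≡_ f →
                 ∀ {u v x y} → SameEdge (f u) (f v) (f x) (f y) → SameEdge u v x y
SameEdge-unmap inj = Sum.map (Product.map inj inj) (Product.map inj inj)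

induced-pullback : ∀ {n k} (G : Graph n) (K : Graph k) {f : Fin n → Fin k} → Injective _≡_ _≡_ f →
  (∀ a b → adj G a b ≡ true → adj K (f a) (f b) ≡ true) →
  ∀ M → IsMatching G (λ i j → M (f i) (f j)) → IsInducedMatching K M →
  IsInducedMatching G (λ i j → M (f i) (f j))
induced-pullback G K {f} inj hom M m (_ , induced) = m , λ u v x y Muv Mxy distinct a b ab (meets₁ , meets₂) →
  induced (f u) (f v) (f x) (f y) Muv Mxy (λ same → distinct (SameEdge-unmap inj same))
          (f a) (f b) (hom a b ab) (Meets-map f meets₁ , Meets-map f meets₂)

module _ {n h : ℕ} (G : Graph n) (H : Graph h) (B : Fin n → Fin h → Bool) where
  private
    K = combineGraph G H B

  module _ (M : EdgeSet (n + h)) (m : IsMatching K M) where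
    private module M = Matching K M m

    restrictˡ-matching : IsMatching G (restrictˡ {n} {h} M)
    restrictˡ-matching =
      (λ i j Mij → trans (sym (combine-ˡˡ (adj G) (adj H) B i j)) (M.⊆adj _ _ Mij)) ,
      (λ i j → M.symmetric _ _) ,
      (λ i j k Mij Mik → ↑ˡ-injective h j k (M.functional _ _ _ Mij Mik))

    restrictʳ-matching : IsMatching H (restrictʳ {n} {h} M)
    restrictʳ-matching =
      (λ i j Mij → trans (sym (combine-ʳʳ (adj G) (adj H) B i j)) (M.⊆adj _ _ Mij)) ,
      (λ i j → M.symmetric _ _) ,
      (λ i j k Mij Mik → ↑ʳ-injective n j k (M.functional _ _ _ Mij Mik))

    between⇒B : ∀ i j → between {n} {h} M i j ≡ true → B i j ≡ true
    between⇒B i j Mij = trans (sym (combine-ˡʳ (adj G) (adj H) B i j)) (M.⊆adj _ _ Mij)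

  module _ (M : EdgeSet (n + h)) (induced : IsInducedMatching K M) where

    restrictˡ-induced : IsInducedMatching G (restrictˡ {n} {h} M)
    restrictˡ-induced = induced-pullback G K (↑ˡ-Injective h)
      (λ a b ab → trans (combine-ˡˡ (adj G) (adj H) B a b) ab) M (restrictˡ-matching M (proj₁ induced)) induced

    restrictʳ-induced : IsInducedMatching H (restrictʳ {n} {h} M)
    restrictʳ-induced = induced-pullback H K (↑ʳ-Injective n)
      (λ a b ab → trans (combine-ʳʳ (adj G) (adj H) B a b) ab) M (restrictʳ-matching M (proj₁ induced)) induced

_⊕_ : ∀ {n h} → EdgeSet n → EdgeSet h → EdgeSet (n + h)
MG ⊕ MH = combine MG MH (λ _ _ → false)

⊕-matching : ∀ {n h} (G : Graph n) (H : Graph h) B {MG : EdgeSet n} {MH : EdgeSet h} →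
             IsMatching G MG → IsMatching H MH → IsMatching (combineGraph G H B) (MG ⊕ MH)
⊕-matching {n} {h} G H B {MG} {MH} mG mH = ⊆adj , combine-symmetric MG MH _ MG.symmetric MH.symmetric , functional
  where
  module MG = Matching G MG mG
  module MH = Matching H MH mH
  none = λ (_ : Fin n) (_ : Fin h) → false
  ⊆adj : ∀ u v → (MG ⊕ MH) u v ≡ true → combine (adj G) (adj H) B u v ≡ true
  ⊆adj u v e with side n h u | side n h v
  ... | left i  | left j  rewrite combine-ˡˡ MG MH none i j | combine-ˡˡ (adj G) (adj H) B i j = MG.⊆adj i j e
  ... | left i  | right j rewrite combine-ˡʳ MG MH none i j = ⊥-elim (true≢false (sym e))
  ... | right i | left j  rewrite combine-ʳˡ MG MH none i j = ⊥-elim (true≢false (sym e))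
  ... | right i | right j rewrite combine-ʳʳ MG MH none i j | combine-ʳʳ (adj G) (adj H) B i j = MH.⊆adj i j e
  functional : ∀ u v w → (MG ⊕ MH) u v ≡ true → (MG ⊕ MH) u w ≡ true → v ≡ w
  functional u v w e e′ with side n h u | side n h v | side n h w
  ... | left i  | left j  | left k  rewrite combine-ˡˡ MG MH none i j | combine-ˡˡ MG MH none i k =
    cong (_↑ˡ h) (MG.functional i j k e e′)
  ... | right i | right j | right k rewrite combine-ʳʳ MG MH none i j | combine-ʳʳ MG MH none i k =
    cong (n ↑ʳ_) (MH.functional i j k e e′)
  ... | left i  | right j | _       rewrite combine-ˡʳ MG MH none i j = ⊥-elim (true≢false (sym e))
  ... | right i | left j  | _       rewrite combine-ʳˡ MG MH none i j = ⊥-elim (true≢false (sym e))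
  ... | left i  | left j  | right k rewrite combine-ˡʳ MG MH none i k = ⊥-elim (true≢false (sym e′))
  ... | right i | right j | left k  rewrite combine-ʳˡ MG MH none i k = ⊥-elim (true≢false (sym e′))

module _ {n h : ℕ} {MG : EdgeSet n} {MH : EdgeSet h} where

  degree-⊕ˡ : ∀ i → degree (MG ⊕ MH) (i ↑ˡ h) ≡ degree MG i
  degree-⊕ˡ i = trans (degree-combineˡ MG MH _ i)
                      (trans (cong (degree MG i +_) (∑-zero {h} (λ _ → refl))) (+-identityʳ _))

  module _ (MG-sym : ∀ i j → MG i j ≡ MG j i) (MH-sym : ∀ i j → MH i j ≡ MH j i) where

    degree-⊕ʳ : ∀ j → degree (MG ⊕ MH) (n ↑ʳ j) ≡ degree MH j
    degree-⊕ʳ j = trans (degree-combineʳ MG MH _ MG-sym MH-sym j)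
                        (cong (_+ degree MH j) (∑-zero {n} (λ _ → refl)))

    degreeSum-⊕ : degreeSum (MG ⊕ MH) ≡ degreeSum MG + degreeSum MH
    degreeSum-⊕ = trans (degreeSum-combine MG MH _ MG-sym MH-sym)
      (trans (cong (λ t → degreeSum MG + degreeSum MH + 2 * t) (∑-zero {n} (λ i → ∑-zero {h} (λ j → refl))))
             (+-identityʳ _))

module _ {n h : ℕ} {MG : EdgeSet n} {MH : EdgeSet h} where

  data ⊕-Edge (u v : Fin (n + h)) : Set where
    inˡ : ∀ {i j} → MG i j ≡ true → u ≡ i ↑ˡ h → v ≡ j ↑ˡ h → ⊕-Edge u v
    inʳ : ∀ {i j} → MH i j ≡ true → u ≡ n ↑ʳ i → v ≡ n ↑ʳ j → ⊕-Edge u v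

  ⊕-edge : ∀ u v → (MG ⊕ MH) u v ≡ true → ⊕-Edge u v
  ⊕-edge u v e with side n h u | side n h v
  ... | left i  | left j  = inˡ (trans (sym (combine-ˡˡ MG MH _ i j)) e) refl refl
  ... | right i | right j = inʳ (trans (sym (combine-ʳʳ MG MH _ i j)) e) refl refl
  ... | left i  | right j = ⊥-elim (true≢false (trans (sym e) (combine-ˡʳ MG MH _ i j)))
  ... | right i | left j  = ⊥-elim (true≢false (trans (sym e) (combine-ʳˡ MG MH _ i j)))

Meets-ˡʳ : ∀ {n h} {a b : Fin n} {u v : Fin h} → ¬ Meets (a ↑ˡ h) (b ↑ˡ h) (n ↑ʳ u) (n ↑ʳ v)
Meets-ˡʳ = Sum.[ Sum.[ ↑ˡ≢↑ʳ _ _ , ↑ˡ≢↑ʳ _ _ ] , Sum.[ ↑ˡ≢↑ʳ _ _ , ↑ˡ≢↑ʳ _ _ ] ]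

Meets-ʳˡ : ∀ {n h} {a b : Fin h} {u v : Fin n} → ¬ Meets (n ↑ʳ a) (n ↑ʳ b) (u ↑ˡ h) (v ↑ˡ h)
Meets-ʳˡ = Sum.[ Sum.[ ≢ʳˡ , ≢ʳˡ ] , Sum.[ ≢ʳˡ , ≢ʳˡ ] ]
  where
  ≢ʳˡ : ∀ {n h} {a : Fin h} {u : Fin n} → n ↑ʳ a ≢ u ↑ˡ h
  ≢ʳˡ e = ↑ˡ≢↑ʳ _ _ (sym e)

Meets-same : ∀ {n} {a b a′ b′ u v : Fin n} → SameEdge a b a′ b′ → Meets a b u v → Meets a′ b′ u v
Meets-same (inj₁ (refl , refl)) = λ meets → meets
Meets-same (inj₂ (refl , refl)) = Sum.swap

-- Attaching one graph to another by an edge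

-- With `excused = true`, ρ is matched by an edge outside the graph: it is not counted as free
-- and may be adjacent to free vertices.
free : ∀ {n} → EdgeSet n → Bool → Fin n → Fin n → Bool
free M excused ρ v = unmatched M v ∧ not (excused ∧ v == ρ)

FreeBound : ∀ {n} → Graph n → Fin n → (Bool → ℕ) → Set
FreeBound {n} G ρ bound = ∀ M excused → IsMatching G M → (excused ≡ true → degree M ρ ≡ 0) →
  (∀ a b → adj G a b ≡ true → free M excused ρ a ≡ true → free M excused ρ b ≡ true → ⊥) →
  ∑[ v < n ] ⟦ free M excused ρ v ⟧ ≤ bound excused

free-unexcused : ∀ {n} (M : EdgeSet n) ρ v → free M false ρ v ≡ unmatched M v
free-unexcused M ρ v = ∧-identityʳ (unmatched M v)

free-≢ : ∀ {n} (M : EdgeSet n) {ρ v} → v ≢ ρ → ∀ excused → free M excused ρ v ≡ unmatched M v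
free-≢ M {ρ} {v} v≢ρ excused rewrite ≢⇒==false v≢ρ | ∧-zeroʳ excused = ∧-identityʳ (unmatched M v)

free-root : ∀ {n} (M : EdgeSet n) ρ excused → (excused ≡ true → degree M ρ ≡ 0) →
            ⟦ free M excused ρ ρ ⟧ + ⟦ excused ⟧ ≡ ⟦ unmatched M ρ ⟧
free-root M ρ false _ = trans (+-identityʳ _) (cong ⟦_⟧ (free-unexcused M ρ ρ))
free-root M ρ true  ρ-unmatched rewrite ==-refl ρ | ∧-zeroʳ (unmatched M ρ) | ρ-unmatched refl = refl

InducedMatchingsAtMost : ∀ {n} → Graph n → ℕ → Set
InducedMatchingsAtMost G k = ∀ M → IsInducedMatching G M → degreeSum M ≤ 2 * k

RootSeesEveryEdge : ∀ {n} → Graph n → Fin n → Set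
RootSeesEveryEdge G x =
  ∀ a b → adj G a b ≡ true → a ≢ x → b ≢ x → ∃[ y ] adj G x y ≡ true × (y ≡ a ⊎ y ≡ b)

attach : ∀ {n h} → Graph n → Fin n → Graph h → Fin h → Graph (n + h)
attach G c H x = combineGraph G H (λ i j → i == c ∧ j == x)

module Attach {n h} (G : Graph n) (c : Fin n) (H : Graph h) (x : Fin h) where

  K : Graph (n + h)
  K = attach G c H x

  bridge : Fin n → Fin h → Bool
  bridge i j = i == c ∧ j == x

  adj-ˡˡ : ∀ i j → adj K (i ↑ˡ h) (j ↑ˡ h) ≡ adj G i j
  adj-ˡˡ = combine-ˡˡ (adj G) (adj H) bridge

  adj-ʳʳ : ∀ i j → adj K (n ↑ʳ i) (n ↑ʳ j) ≡ adj H i j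
  adj-ʳʳ = combine-ʳʳ (adj G) (adj H) bridge

  adj-ˡʳ : ∀ i j → adj K (i ↑ˡ h) (n ↑ʳ j) ≡ bridge i j
  adj-ˡʳ = combine-ˡʳ (adj G) (adj H) bridge

  adj-ʳˡ : ∀ i j → adj K (n ↑ʳ i) (j ↑ˡ h) ≡ bridge j i
  adj-ʳˡ = combine-ʳˡ (adj G) (adj H) bridge

  adj-bridge : adj K (c ↑ˡ h) (n ↑ʳ x) ≡ true
  adj-bridge = trans (adj-ˡʳ c x) (cong₂ _∧_ (==-refl c) (==-refl x))

  liftˡ : ∀ {u v} → Reach G u v → Reach K (u ↑ˡ h) (v ↑ˡ h)
  liftˡ = reach-map (_↑ˡ h) (λ a b ab → trans (adj-ˡˡ a b) ab)

  liftʳ : ∀ {u v} → Reach H u v → Reach K (n ↑ʳ u) (n ↑ʳ v)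
  liftʳ = reach-map (n ↑ʳ_) (λ a b ab → trans (adj-ʳʳ a b) ab)

  connected : Connected G → Connected H → Connected K
  connected G-conn H-conn = connected-via (c ↑ˡ h) toC
    where
    toC : ∀ u → Reach K u (c ↑ˡ h)
    toC u with side n h u
    ... | left i  = liftˡ (G-conn i c)
    ... | right j = reach-trans (liftʳ (H-conn j x))
                                (step (trans (Graph.sym K _ _) adj-bridge) here)

  degreeSum-adj : degreeSum (adj K) ≡ degreeSum (adj G) + degreeSum (adj H) + 2
  degreeSum-adj = trans (degreeSum-combine (adj G) (adj H) bridge (Graph.sym G) (Graph.sym H))
                        (cong (λ t → degreeSum (adj G) + degreeSum (adj H) + 2 * t) (∑∑-point c x))

  module Split (M : EdgeSet (n + h)) (m : IsMatching K M) where
    private module M = Matching K M m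

    Mˡ : EdgeSet n
    Mˡ = restrictˡ {n} {h} M

    Mʳ : EdgeSet h
    Mʳ = restrictʳ {n} {h} M

    usesBridge : Bool
    usesBridge = between {n} {h} M c x

    between-off : ∀ i j → (i ≢ c ⊎ j ≢ x) → between {n} {h} M i j ≡ false
    between-off i j off = ¬-not λ Mij →
      let i=c , j=x = ∧-true {i == c} (between⇒B G H bridge M m i j Mij)
      in Sum.[ (λ i≢c → i≢c (==⇒≡ i=c)) , (λ j≢x → j≢x (==⇒≡ j=x)) ] off

    crossingˡ : ∀ i → ∑[ j < h ] ⟦ between {n} {h} M i j ⟧ ≡ ⟦ i == c ∧ usesBridge ⟧
    crossingˡ i with i ≟ c
    ... | yes refl = ∑-single x (λ j j≢x → cong ⟦_⟧ (between-off c j (inj₂ j≢x)))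
    ... | no i≢c   = ∑-zero {h} (λ j → cong ⟦_⟧ (between-off i j (inj₁ i≢c)))

    crossingʳ : ∀ j → ∑[ i < n ] ⟦ between {n} {h} M i j ⟧ ≡ ⟦ j == x ∧ usesBridge ⟧
    crossingʳ j with j ≟ x
    ... | yes refl = ∑-single c (λ i i≢c → cong ⟦_⟧ (between-off i x (inj₁ i≢c)))
    ... | no j≢x   = ∑-zero {n} (λ i → cong ⟦_⟧ (between-off i j (inj₂ j≢x)))

    degreeˡ≡ : ∀ i → degree M (i ↑ˡ h) ≡ degree Mˡ i + ⟦ i == c ∧ usesBridge ⟧
    degreeˡ≡ i = trans (degreeˡ {n} {h} M i) (cong (degree Mˡ i +_) (crossingˡ i))

    degreeʳ≡ : ∀ j → degree M (n ↑ʳ j) ≡ ⟦ j == x ∧ usesBridge ⟧ + degree Mʳ j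
    degreeʳ≡ j = trans (degreeʳ {n} {h} M M.symmetric j) (cong (_+ degree Mʳ j) (crossingʳ j))

    degreeSum≡ : degreeSum M ≡ degreeSum Mˡ + degreeSum Mʳ + 2 * ⟦ usesBridge ⟧
    degreeSum≡ = trans (degreeSum-split {n} {h} M M.symmetric)
      (cong (λ t → degreeSum Mˡ + degreeSum Mʳ + 2 * t)
            (trans (sum-cong-≗ crossingˡ)
                   (trans (∑-single c (λ i i≢c → cong (λ t → ⟦ t ∧ usesBridge ⟧) (≢⇒==false i≢c)))
                          (cong (λ t → ⟦ t ∧ usesBridge ⟧) (==-refl c)))))

    degree-c : degree M (c ↑ˡ h) ≡ degree Mˡ c + ⟦ usesBridge ⟧
    degree-c = trans (degreeˡ≡ c) (cong (λ t → degree Mˡ c + ⟦ t ∧ usesBridge ⟧) (==-refl c))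

    degree-x : degree M (n ↑ʳ x) ≡ ⟦ usesBridge ⟧ + degree Mʳ x
    degree-x = trans (degreeʳ≡ x) (cong (λ t → ⟦ t ∧ usesBridge ⟧ + degree Mʳ x) (==-refl x))

    bridge⇒c-unmatchedˡ : usesBridge ≡ true → degree Mˡ c ≡ 0
    bridge⇒c-unmatchedˡ used = n≤0⇒n≡0 (≤-pred (subst (_≤ 1)
      (trans degree-c (trans (cong (λ t → degree Mˡ c + ⟦ t ⟧) used) (+-comm (degree Mˡ c) 1)))
      (M.degree≤1 (c ↑ˡ h))))

    bridge⇒x-unmatchedʳ : usesBridge ≡ true → degree Mʳ x ≡ 0
    bridge⇒x-unmatchedʳ used = n≤0⇒n≡0 (≤-pred (subst (_≤ 1)
      (trans degree-x (cong (λ t → ⟦ t ⟧ + degree Mʳ x) used))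
      (M.degree≤1 (n ↑ʳ x))))

  private
    unmatched-plusʳ : ∀ d t k e →
                      ((d + ⟦ t ∧ k ⟧) ≡ᵇ 0) ∧ not (e ∧ t) ≡ (d ≡ᵇ 0) ∧ not ((e ∨ k) ∧ t)
    unmatched-plusʳ (suc d) t     k     e     = refl
    unmatched-plusʳ zero    true  true  true  = refl
    unmatched-plusʳ zero    true  true  false = refl
    unmatched-plusʳ zero    true  false true  = refl
    unmatched-plusʳ zero    true  false false = refl
    unmatched-plusʳ zero    false true  true  = refl
    unmatched-plusʳ zero    false true  false = refl
    unmatched-plusʳ zero    false false true  = refl
    unmatched-plusʳ zero    false false false = refl

    unmatched-plusˡ : ∀ d t k e →
                      ((⟦ t ∧ k ⟧ + d) ≡ᵇ 0) ∧ not (e ∧ false) ≡ (d ≡ᵇ 0) ∧ not (k ∧ t)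
    unmatched-plusˡ d true  true  e = sym (∧-zeroʳ (d ≡ᵇ 0))
    unmatched-plusˡ d true  false e rewrite ∧-zeroʳ e = refl
    unmatched-plusˡ d false true  e rewrite ∧-zeroʳ e = refl
    unmatched-plusˡ d false false e rewrite ∧-zeroʳ e = refl

  ==-↑ˡ : ∀ (i j : Fin n) → ((i ↑ˡ h) == (j ↑ˡ h)) ≡ (i == j)
  ==-↑ˡ i j with i ≟ j
  ... | yes refl = ==-refl (i ↑ˡ h)
  ... | no i≢j   = ≢⇒==false (λ e → i≢j (↑ˡ-injective h i j e))

  freeBound : ∀ {β δ} → FreeBound G c (λ e → ⟦ not e ⟧ + β) → FreeBound H x (λ e → ⟦ e ⟧ + δ) →
              FreeBound K (c ↑ˡ h) (λ e → ⟦ not e ⟧ + (β + δ))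
  freeBound {β} {δ} boundG boundH M excused m c-unmatched independent = begin
    ∑[ v < n + h ] ⟦ free M excused (c ↑ˡ h) v ⟧
      ≡⟨ ∑-++ {n} {h} _ ⟩
    ∑[ i < n ] ⟦ free M excused (c ↑ˡ h) (i ↑ˡ h) ⟧ + ∑[ j < h ] ⟦ free M excused (c ↑ˡ h) (n ↑ʳ j) ⟧
      ≡⟨ cong₂ _+_ (sum-cong-≗ (cong ⟦_⟧ ∘ freeˡ)) (sum-cong-≗ (cong ⟦_⟧ ∘ freeʳ)) ⟩
    ∑[ i < n ] ⟦ free Mˡ (excused ∨ usesBridge) c i ⟧ + ∑[ j < h ] ⟦ free Mʳ usesBridge x j ⟧
      ≤⟨ +-mono-≤ boundˡ boundʳ ⟩
    (⟦ not (excused ∨ usesBridge) ⟧ + β) + (⟦ usesBridge ⟧ + δ)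
      ≤⟨ settle excused usesBridge refl refl ⟩
    ⟦ not excused ⟧ + (β + δ) ∎
    where
    open ≤-Reasoning
    open Split M m

    freeˡ : ∀ i → free M excused (c ↑ˡ h) (i ↑ˡ h) ≡ free Mˡ (excused ∨ usesBridge) c i
    freeˡ i = trans (cong₂ (λ d t → (d ≡ᵇ 0) ∧ not (excused ∧ t)) (degreeˡ≡ i) (==-↑ˡ i c))
                    (unmatched-plusʳ (degree Mˡ i) (i == c) usesBridge excused)

    freeʳ : ∀ j → free M excused (c ↑ˡ h) (n ↑ʳ j) ≡ free Mʳ usesBridge x j
    freeʳ j = trans (cong₂ (λ d t → (d ≡ᵇ 0) ∧ not (excused ∧ t))
                           (degreeʳ≡ j) (≢⇒==false (λ e → ↑ˡ≢↑ʳ c j (sym e))))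
                    (unmatched-plusˡ (degree Mʳ j) (j == x) usesBridge excused)

    c-unmatchedˡ : (excused ∨ usesBridge) ≡ true → degree Mˡ c ≡ 0
    c-unmatchedˡ e with ∨-true {excused} e
    ... | inj₁ exc  = m+n≡0⇒m≡0 (degree Mˡ c) (trans (sym degree-c) (c-unmatched exc))
    ... | inj₂ used = bridge⇒c-unmatchedˡ used

    boundˡ : ∑[ i < n ] ⟦ free Mˡ (excused ∨ usesBridge) c i ⟧ ≤ ⟦ not (excused ∨ usesBridge) ⟧ + β
    boundˡ = boundG Mˡ (excused ∨ usesBridge) (restrictˡ-matching G H bridge M m) c-unmatchedˡ
      (λ a b ab a-free b-free → independent (a ↑ˡ h) (b ↑ˡ h) (trans (adj-ˡˡ a b) ab)
                                   (trans (freeˡ a) a-free) (trans (freeˡ b) b-free))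

    boundʳ : ∑[ j < h ] ⟦ free Mʳ usesBridge x j ⟧ ≤ ⟦ usesBridge ⟧ + δ
    boundʳ = boundH Mʳ usesBridge (restrictʳ-matching G H bridge M m) bridge⇒x-unmatchedʳ
      (λ a b ab a-free b-free → independent (n ↑ʳ a) (n ↑ʳ b) (trans (adj-ʳʳ a b) ab)
                                   (trans (freeʳ a) a-free) (trans (freeʳ b) b-free))

    settle : ∀ e k → excused ≡ e → usesBridge ≡ k →
             (⟦ not (e ∨ k) ⟧ + β) + (⟦ k ⟧ + δ) ≤ ⟦ not e ⟧ + (β + δ)
    settle false false _ _ = ≤-refl
    settle false true  _ _ = ≤-reflexive (+-suc β δ)
    settle true  false _ _ = ≤-refl
    settle true  true  exc used = ⊥-elim (0≢1+n (trans (sym (c-unmatched exc))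
      (trans degree-c (trans (cong (λ t → degree Mˡ c + ⟦ t ⟧) used) (+-comm (degree Mˡ c) 1)))))

  data Edge (a b : Fin (n + h)) : Set where
    inG      : ∀ {i j} → adj G i j ≡ true → a ≡ i ↑ˡ h → b ≡ j ↑ˡ h → Edge a b
    inH      : ∀ {i j} → adj H i j ≡ true → a ≡ n ↑ʳ i → b ≡ n ↑ʳ j → Edge a b
    isBridge : SameEdge a b (c ↑ˡ h) (n ↑ʳ x) → Edge a b

  edge : ∀ a b → adj K a b ≡ true → Edge a b
  edge a b ab with side n h a | side n h b
  ... | left i  | left j  = inG (trans (sym (adj-ˡˡ i j)) ab) refl refl
  ... | right i | right j = inH (trans (sym (adj-ʳʳ i j)) ab) refl refl
  ... | left i  | right j =
    let i=c , j=x = ∧-true {i == c} (trans (sym (adj-ˡʳ i j)) ab)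
    in isBridge (inj₁ (cong (_↑ˡ h) (==⇒≡ i=c) , cong (n ↑ʳ_) (==⇒≡ j=x)))
  ... | right i | left j  =
    let j=c , i=x = ∧-true {j == c} (trans (sym (adj-ʳˡ i j)) ab)
    in isBridge (inj₂ (cong (n ↑ʳ_) (==⇒≡ i=x) , cong (_↑ˡ h) (==⇒≡ j=c)))

  Meets-bridgeˡ : ∀ {i j} → Meets (c ↑ˡ h) (n ↑ʳ x) (i ↑ˡ h) (j ↑ˡ h) → c ≡ i ⊎ c ≡ j
  Meets-bridgeˡ = Sum.[ Sum.map (↑ˡ-injective h _ _) (↑ˡ-injective h _ _)
                      , (λ meets → ⊥-elim (Meets-ʳˡ {a = x} {x} (inj₁ meets))) ]

  Meets-bridgeʳ : ∀ {i j} → Meets (c ↑ˡ h) (n ↑ʳ x) (n ↑ʳ i) (n ↑ʳ j) → x ≡ i ⊎ x ≡ j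
  Meets-bridgeʳ = Sum.[ (λ meets → ⊥-elim (Meets-ˡʳ {a = c} {c} (inj₁ meets)))
                      , Sum.map (↑ʳ-injective n _ _) (↑ʳ-injective n _ _) ]

  inducedBound : ∀ {k} → InducedMatchingsAtMost G k → InducedMatchingsAtMost H 1 → RootSeesEveryEdge H x →
                 InducedMatchingsAtMost K (k + 1)
  inducedBound {k} boundG boundH seesH M induced = begin
    degreeSum M                                        ≡⟨ degreeSum≡ ⟩
    degreeSum Mˡ + degreeSum Mʳ + 2 * ⟦ usesBridge ⟧    ≡⟨ +-assoc (degreeSum Mˡ) _ _ ⟩
    degreeSum Mˡ + (degreeSum Mʳ + 2 * ⟦ usesBridge ⟧)  ≤⟨ +-mono-≤ leftPart (rightPart usesBridge refl) ⟩
    2 * k + 2                                          ≡⟨ *-distribˡ-+ 2 k 1 ⟨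
    2 * (k + 1)                                        ∎
    where
    open ≤-Reasoning
    open Split M (proj₁ induced)
    mʳ = restrictʳ-matching G H bridge M (proj₁ induced)

    leftPart : degreeSum Mˡ ≤ 2 * k
    leftPart = boundG Mˡ (restrictˡ-induced G H bridge M induced)

    x-unmatched : usesBridge ≡ true → ∀ {u v} → Mʳ u v ≡ true → u ≢ x
    x-unmatched used Muv refl =
      0≢1+n (sym (n≤0⇒n≡0 (subst (1 ≤_) (bridge⇒x-unmatchedʳ used) (edge⇒degree>0 Mʳ x _ Muv))))

    -- An H-edge of M would be joined to the bridge edge through the neighbour of x that it contains.
    bridge⇒Mʳ-empty : usesBridge ≡ true → ∀ a b → Mʳ a b ≡ false
    bridge⇒Mʳ-empty used a b = ¬-not λ Mab →
      let y , xy , y∈ab = seesH a b (Matching.⊆adj H Mʳ mʳ a b Mab) (x-unmatched used Mab)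
                                (x-unmatched used (trans (Matching.symmetric H Mʳ mʳ b a) Mab))
      in proj₂ induced (c ↑ˡ h) (n ↑ʳ x) (n ↑ʳ a) (n ↑ʳ b) used Mab
           Sum.[ (λ (e , _) → ↑ˡ≢↑ʳ c a e) , (λ (e , _) → ↑ˡ≢↑ʳ c b e) ]
           (n ↑ʳ x) (n ↑ʳ y) (trans (adj-ʳʳ x y) xy)
           (inj₁ (inj₂ refl) , inj₂ (Sum.map (cong (n ↑ʳ_)) (cong (n ↑ʳ_)) y∈ab))

    rightPart : ∀ b → usesBridge ≡ b → degreeSum Mʳ + 2 * ⟦ b ⟧ ≤ 2
    rightPart false _ = ≤-trans (≤-reflexive (+-identityʳ _)) (boundH Mʳ (restrictʳ-induced G H bridge M induced))
    rightPart true  used rewrite ∑-zero {h} (λ a → ∑-zero {h} λ b → cong ⟦_⟧ (bridge⇒Mʳ-empty used a b)) = ≤-refl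

  module _ {MG : EdgeSet n} {MH : EdgeSet h} (mG : IsMatching G MG) (mH : IsMatching H MH) where

    unmatched-⊕ˡ : ∀ i → unmatched (MG ⊕ MH) (i ↑ˡ h) ≡ unmatched MG i
    unmatched-⊕ˡ i = cong (_≡ᵇ 0) (degree-⊕ˡ {MH = MH} i)

    unmatched-⊕ʳ : ∀ j → unmatched (MG ⊕ MH) (n ↑ʳ j) ≡ unmatched MH j
    unmatched-⊕ʳ j = cong (_≡ᵇ 0) (degree-⊕ʳ (Matching.symmetric G MG mG) (Matching.symmetric H MH mH) j)

    ⊕-unmatchedIndependent : UnmatchedIndependent G MG → UnmatchedIndependent H MH → unmatched MH x ≡ false →
                             UnmatchedIndependent K (MG ⊕ MH)
    ⊕-unmatchedIndependent indG indH x-matched a b ab a-free b-free with edge a b ab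
    ... | inG ij refl refl = indG _ _ ij (trans (sym (unmatched-⊕ˡ _)) a-free) (trans (sym (unmatched-⊕ˡ _)) b-free)
    ... | inH ij refl refl = indH _ _ ij (trans (sym (unmatched-⊕ʳ _)) a-free) (trans (sym (unmatched-⊕ʳ _)) b-free)
    ... | isBridge (inj₁ (refl , refl)) = true≢false (trans (sym b-free) (trans (unmatched-⊕ʳ x) x-matched))
    ... | isBridge (inj₂ (refl , refl)) = true≢false (trans (sym a-free) (trans (unmatched-⊕ʳ x) x-matched))

    ⊕-induced : IsInducedMatching G MG → degree MG c ≡ 0 → IsInducedMatching H MH →
                IsInducedMatching K (MG ⊕ MH)
    ⊕-induced (_ , indG) c-unmatched (_ , indH) = ⊕-matching G H bridge mG mH , separated
      where
      c-uncovered : ∀ {i j} → MG i j ≡ true → c ≡ i ⊎ c ≡ j → ⊥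
      c-uncovered {i} {j} Mij c∈ij = 0≢1+n (sym (n≤0⇒n≡0 (subst (1 ≤_) c-unmatched (at-c c∈ij))))
        where
        at-c : c ≡ i ⊎ c ≡ j → 0 < degree MG c
        at-c (inj₁ refl) = edge⇒degree>0 MG c j Mij
        at-c (inj₂ refl) = edge⇒degree>0 MG c i (trans (Matching.symmetric G MG mG j i) Mij)

      separated : ∀ u v u′ v′ → (MG ⊕ MH) u v ≡ true → (MG ⊕ MH) u′ v′ ≡ true →
                  ¬ SameEdge u v u′ v′ →
                  ∀ a b → adj K a b ≡ true → ¬ (Meets a b u v × Meets a b u′ v′)
      separated u v u′ v′ e e′ distinct a b ab (meets , meets′)
        with ⊕-edge {MG = MG} {MH} u v e | ⊕-edge {MG = MG} {MH} u′ v′ e′ | edge a b ab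
      ... | inˡ Mij refl refl | inˡ Mij′ refl refl | inG pq refl refl =
        indG _ _ _ _ Mij Mij′ (λ same → distinct (SameEdge-map (_↑ˡ h) same)) _ _ pq
             (Meets-unmap (↑ˡ-Injective h) meets , Meets-unmap (↑ˡ-Injective h) meets′)
      ... | inʳ Mij refl refl | inʳ Mij′ refl refl | inH pq refl refl =
        indH _ _ _ _ Mij Mij′ (λ same → distinct (SameEdge-map (n ↑ʳ_) same)) _ _ pq
             (Meets-unmap (↑ʳ-Injective n) meets , Meets-unmap (↑ʳ-Injective n) meets′)
      ... | inʳ _ refl refl | _                 | inG _ refl refl = Meets-ˡʳ meets
      ... | _               | inʳ _ refl refl   | inG _ refl refl = Meets-ˡʳ meets′
      ... | inˡ _ refl refl | _                 | inH _ refl refl = Meets-ʳˡ meets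
      ... | _               | inˡ _ refl refl   | inH _ refl refl = Meets-ʳˡ meets′
      ... | inˡ Mij refl refl | _                 | isBridge same =
        c-uncovered Mij (Meets-bridgeˡ (Meets-same same meets))
      ... | _                 | inˡ Mij′ refl refl | isBridge same =
        c-uncovered Mij′ (Meets-bridgeˡ (Meets-same same meets′))
      ... | inʳ Mij refl refl | inʳ Mij′ refl refl | isBridge same =
        distinct (SameEdge-map (n ↑ʳ_) (Matching.sharedVertex⇒same H MH mH Mij Mij′ x
          (Meets-bridgeʳ (Meets-same same meets)) (Meets-bridgeʳ (Meets-same same meets′))))

freeBound⇒unmatchedBound : ∀ {n} {G : Graph n} {ρ bound} → FreeBound G ρ bound →
  ∀ {M} → IsMatching G M → UnmatchedIndependent G M → ∑[ v < n ] ⟦ unmatched M v ⟧ ≤ bound false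
freeBound⇒unmatchedBound {n} {ρ = ρ} bounded {M} m independent =
  subst (_≤ _) (sum-cong-≗ {n} (λ v → cong ⟦_⟧ (free-unexcused M ρ v)))
    (bounded M false m (λ ()) λ a b ab a-free b-free →
       independent a b ab (trans (sym (free-unexcused M ρ a)) a-free) (trans (sym (free-unexcused M ρ b)) b-free))

-- Gadgets

SameEdge? : ∀ {n} (u v x y : Fin n) → Dec (SameEdge u v x y)
SameEdge? u v x y = (u ≟ x ×-dec v ≟ y) ⊎-dec (u ≟ y ×-dec v ≟ x)

module _ {n} (G : Graph n) (M : EdgeSet n) (m : IsMatching G M) where
  private module M = Matching G M m

  oneEdge⇒degreeSum≤2 : (∀ u v x y → M u v ≡ true → M x y ≡ true → SameEdge u v x y) → degreeSum M ≤ 2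
  oneEdge⇒degreeSum≤2 same with degreeSum M in eq
  ... | zero  = z≤n
  ... | suc _ with ∑>0⇒∃ (degree M) (subst (0 <_) (sym eq) (s≤s z≤n))
  ...   | u , u-matched with unmatched⊎edge M u
  ...     | inj₁ u-free = ⊥-elim (true≢false (trans (sym u-free) (matched u-matched)))
    where
    matched : ∀ {w} → 0 < degree M w → unmatched M w ≡ false
    matched {w} d>0 with degree M w | d>0
    ... | suc _ | _ = refl
  ...     | inj₂ (v , Muv) = subst (_≤ 2) eq (begin
    degreeSum M                                          ≤⟨ ∑-mono endpoint ⟩
    ∑[ w < n ] (⟦ u == w ⟧ + ⟦ v == w ⟧)                  ≡⟨ ∑-distrib-+ (⟦_⟧ ∘ (u ==_)) (⟦_⟧ ∘ (v ==_)) ⟩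
    ∑[ w < n ] ⟦ u == w ⟧ + ∑[ w < n ] ⟦ v == w ⟧         ≡⟨ cong₂ _+_ (∑-==ˡ u) (∑-==ˡ v) ⟩
    2                                                    ∎)
    where
    open ≤-Reasoning
    endpoint : ∀ w → degree M w ≤ ⟦ u == w ⟧ + ⟦ v == w ⟧
    endpoint w with unmatched⊎edge M w
    ... | inj₁ w-free = subst (_≤ _) (sym (degree≡0 w-free)) z≤n
      where
      degree≡0 : ∀ {w} → unmatched M w ≡ true → degree M w ≡ 0
      degree≡0 {w} e with degree M w | e
      ... | zero | _ = refl
    ... | inj₂ (z , Mwz) with same u v w z Muv Mwz
    ...   | inj₁ (refl , _) rewrite ==-refl w = ≤-trans (M.degree≤1 w) (m≤m+n 1 _)
    ...   | inj₂ (_ , refl) rewrite ==-refl w = ≤-trans (M.degree≤1 w) (m≤n+m 1 _)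

EdgesPairwiseLinked : ∀ {n} → Graph n → Set
EdgesPairwiseLinked G = ∀ u v x y → adj G u v ≡ true → adj G x y ≡ true → ¬ SameEdge u v x y →
  ∃₂ λ a b → adj G a b ≡ true × Meets a b u v × Meets a b x y

linked⇒inducedMatchingsAtMost1 : ∀ {n} (G : Graph n) → EdgesPairwiseLinked G → InducedMatchingsAtMost G 1
linked⇒inducedMatchingsAtMost1 G linked M (m , induced) = oneEdge⇒degreeSum≤2 G M m λ u v x y Muv Mxy →
  decidable-stable (SameEdge? u v x y) λ distinct →
    let a , b , ab , meets = linked u v x y (Matching.⊆adj G M m u v Muv) (Matching.⊆adj G M m x y Mxy) distinct
    in induced u v x y Muv Mxy distinct a b ab meets

emptyGraph : ∀ n → Graph n
emptyGraph n = record { adj = emptyEdges ; sym = λ _ _ → refl ; irrefl = λ _ → refl }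

clique : ∀ n → Graph n
clique n = record
  { adj    = λ i j → not (i == j)
  ; sym    = λ i j → cong not (==-sym i j)
  ; irrefl = λ i → cong not (==-refl i)
  }

rungs : ∀ s → EdgeSet (s + s)
rungs s = combine {s} {s} emptyEdges emptyEdges _==_

module _ {s : ℕ} where

  degree-rungs : ∀ v → degree (rungs s) v ≡ 1
  degree-rungs v with side s s v
  ... | left i  = trans (degree-combineˡ emptyEdges emptyEdges _==_ i) (cong₂ _+_ (degree-empty i) (∑-==ˡ i))
  ... | right j = trans (degree-combineʳ emptyEdges emptyEdges _==_ (λ _ _ → refl) (λ _ _ → refl) j)
                        (cong₂ _+_ (∑-==ʳ j) (degree-empty j))

  degreeSum-rungs : degreeSum (rungs s) ≡ s + s
  degreeSum-rungs = trans (sum-cong-≗ degree-rungs) (trans (∑-const (s + s) 1) (*-identityʳ (s + s)))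

  Rung : Fin (s + s) → Fin (s + s) → Set
  Rung u v = ∃[ i ] ((u ≡ i ↑ˡ s × v ≡ s ↑ʳ i) ⊎ (u ≡ s ↑ʳ i × v ≡ i ↑ˡ s))

  rungs⇒Rung : ∀ u v → rungs s u v ≡ true → Rung u v
  rungs⇒Rung u v e with side s s u | side s s v
  ... | left i  | left j  = ⊥-elim (true≢false (trans (sym e) (combine-ˡˡ {s} {s} emptyEdges emptyEdges _==_ i j)))
  ... | right i | right j = ⊥-elim (true≢false (trans (sym e) (combine-ʳʳ {s} {s} emptyEdges emptyEdges _==_ i j)))
  ... | left i  | right j with ==⇒≡ {i = i} (trans (sym (combine-ˡʳ {s} {s} emptyEdges emptyEdges _==_ i j)) e)
  ...   | refl = i , inj₁ (refl , refl)
  rungs⇒Rung u v e | right i | left j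
    with ==⇒≡ {i = j} (trans (sym (combine-ʳˡ {s} {s} emptyEdges emptyEdges _==_ i j)) e)
  ...   | refl = i , inj₂ (refl , refl)

  rungs-matching : ∀ (G : Graph (s + s)) → (∀ i → adj G (i ↑ˡ s) (s ↑ʳ i) ≡ true) → IsMatching G (rungs s)
  rungs-matching G rung =
    ⊆adj , combine-symmetric {s} {s} emptyEdges emptyEdges _==_ (λ _ _ → refl) (λ _ _ → refl) , functional
    where
    ⊆adj : ∀ u v → rungs s u v ≡ true → adj G u v ≡ true
    ⊆adj u v e with rungs⇒Rung u v e
    ... | i , inj₁ (refl , refl) = rung i
    ... | i , inj₂ (refl , refl) = trans (Graph.sym G _ _) (rung i)
    functional : ∀ u v w → rungs s u v ≡ true → rungs s u w ≡ true → v ≡ w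
    functional u v w e e′ with rungs⇒Rung u v e | rungs⇒Rung u w e′
    ... | i , inj₁ (refl , refl) | j , inj₁ (i=j , refl) = cong (s ↑ʳ_) (↑ˡ-injective s i j i=j)
    ... | i , inj₂ (refl , refl) | j , inj₂ (i=j , refl) = cong (_↑ˡ s) (↑ʳ-injective s i j i=j)
    ... | i , inj₁ (refl , refl) | j , inj₂ (i=j , _)    = ⊥-elim (↑ˡ≢↑ʳ i j i=j)
    ... | i , inj₂ (refl , refl) | j , inj₁ (i=j , _)    = ⊥-elim (↑ˡ≢↑ʳ j i (sym i=j))

completeBipartite : ∀ s → Graph (s + s)
completeBipartite s = combineGraph (emptyGraph s) (emptyGraph s) (λ _ _ → true)

module _ {s} (B : Fin s → Fin s → Bool) (M : EdgeSet (s + s))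
         (m : IsMatching (combineGraph (emptyGraph s) (emptyGraph s) B) M) where
  private
    G = combineGraph (emptyGraph s) (emptyGraph s) B
    module M = Matching G M m

  -- Every edge of M crosses, so both sides carry the same number of matched vertices.
  bipartite-balanced : ∑[ i < s ] ⟦ unmatched M (i ↑ˡ s) ⟧ ≡ ∑[ j < s ] ⟦ unmatched M (s ↑ʳ j) ⟧
  bipartite-balanced = +-cancelˡ-≡ (crossing {s} {s} M) _ _ (begin
    crossing {s} {s} M + ∑[ i < s ] ⟦ unmatched M (i ↑ˡ s) ⟧
      ≡⟨ cong (_+ ∑[ i < s ] ⟦ unmatched M (i ↑ˡ s) ⟧) (sum-cong-≗ degreeˡ-crossing) ⟨
    ∑[ i < s ] degree M (i ↑ˡ s) + ∑[ i < s ] ⟦ unmatched M (i ↑ˡ s) ⟧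
      ≡⟨ side-total (_↑ˡ s) ⟩
    s
      ≡⟨ side-total (s ↑ʳ_) ⟨
    ∑[ j < s ] degree M (s ↑ʳ j) + ∑[ j < s ] ⟦ unmatched M (s ↑ʳ j) ⟧
      ≡⟨ cong (_+ ∑[ j < s ] ⟦ unmatched M (s ↑ʳ j) ⟧)
              (trans (sum-cong-≗ degreeʳ-crossing) (sym (∑-comm (λ i j → ⟦ between {s} {s} M i j ⟧)))) ⟩
    ∑[ i < s ] ∑[ j < s ] ⟦ between {s} {s} M i j ⟧ + ∑[ j < s ] ⟦ unmatched M (s ↑ʳ j) ⟧ ∎)
    where
    open ≡-Reasoning
    noInnerEdge : ∀ {u v} → combine emptyEdges emptyEdges B u v ≡ false → ⟦ M u v ⟧ ≡ 0
    noInnerEdge no-uv = cong ⟦_⟧ (M.nonAdjacent⇒false _ _ no-uv)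
    degreeˡ-crossing : ∀ i → degree M (i ↑ˡ s) ≡ ∑[ j < s ] ⟦ between {s} {s} M i j ⟧
    degreeˡ-crossing i = trans (degreeˡ {s} {s} M i)
      (cong (_+ ∑[ j < s ] ⟦ between {s} {s} M i j ⟧)
            (∑-zero {s} (λ j → noInnerEdge (combine-ˡˡ emptyEdges emptyEdges B i j))))
    degreeʳ-crossing : ∀ j → degree M (s ↑ʳ j) ≡ ∑[ i < s ] ⟦ between {s} {s} M i j ⟧
    degreeʳ-crossing j = trans (degreeʳ {s} {s} M M.symmetric j)
      (trans (cong (∑[ i < s ] ⟦ between {s} {s} M i j ⟧ +_)
                   (∑-zero {s} (λ i → noInnerEdge (combine-ʳʳ emptyEdges emptyEdges B j i))))
             (+-identityʳ _))
    side-total : (f : Fin s → Fin (s + s)) → ∑[ i < s ] degree M (f i) + ∑[ i < s ] ⟦ unmatched M (f i) ⟧ ≡ s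
    side-total f = begin
      ∑[ i < s ] degree M (f i) + ∑[ i < s ] ⟦ unmatched M (f i) ⟧
        ≡⟨ ∑-distrib-+ (λ i → degree M (f i)) (λ i → ⟦ unmatched M (f i) ⟧) ⟨
      ∑[ i < s ] (degree M (f i) + ⟦ unmatched M (f i) ⟧)
        ≡⟨ sum-cong-≗ (λ i → M.degree+unmatched≡1 (f i)) ⟩
      ∑[ i < s ] 1
        ≡⟨ trans (∑-const s 1) (*-identityʳ s) ⟩
      s ∎

-- A rooted graph to be hung from the centre of a star by an edge at its root.
record Gadget : Set where
  field
    order            : ℕ
    graph            : Graph order
    root             : Fin order
    size match minMatch deficiency : ℕ
    degreeSum≡       : degreeSum (adj graph) ≡ 2 * size
    connected        : Connected graph
    order≡match      : order ≡ 2 * match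
    order≡minMatch   : order ≡ 2 * minMatch + deficiency
    perfectMatching  : Σ (EdgeSet order) λ M → IsMatching graph M × degreeSum M ≡ order
    sparseMaximal    : Σ (EdgeSet order) λ M → IsMatching graph M × unmatched M root ≡ false ×
                         UnmatchedIndependent graph M × degreeSum M ≡ 2 * minMatch
    freeBound        : FreeBound graph root (λ excused → ⟦ excused ⟧ + deficiency)
    inducedAtMost1   : InducedMatchingsAtMost graph 1
    rootSeesEveryEdge : RootSeesEveryEdge graph root
    someEdge         : ∃₂ λ a b → adj graph a b ≡ true

module Biclique (s′ : ℕ) where
  s : ℕ
  s = suc s′

  G : Graph (s + s)
  G = completeBipartite s

  root : Fin (s + s)
  root = zero ↑ˡ s

  adj-ˡʳ : ∀ i j → adj G (i ↑ˡ s) (s ↑ʳ j) ≡ true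
  adj-ˡʳ = combine-ˡʳ {s} {s} emptyEdges emptyEdges (λ _ _ → true)

  -- Both sides leave equally many vertices unmatched, and the free ones cannot lie on both sides.
  freeBound : FreeBound G root (λ excused → ⟦ excused ⟧ + 0)
  freeBound M excused m root-unmatched independent = begin
    ∑[ v < s + s ] ⟦ free M excused root v ⟧
      ≡⟨ ∑-++ {s} {s} (λ v → ⟦ free M excused root v ⟧) ⟩
    fL + ∑[ j < s ] ⟦ free M excused root (s ↑ʳ j) ⟧
      ≡⟨ cong (fL +_) (sum-cong-≗ (λ j → cong ⟦_⟧ (freeʳ j))) ⟩
    fL + uR
      ≤⟨ settle fL uR ⟦ excused ⟧ (trans rootAccount (bipartite-balanced (λ _ _ → true) M m)) noFreePair ⟩
    ⟦ excused ⟧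
      ≡⟨ +-identityʳ ⟦ excused ⟧ ⟨
    ⟦ excused ⟧ + 0 ∎
    where
    open ≤-Reasoning

    fL uR : ℕ
    fL = ∑[ i < s ] ⟦ free M excused root (i ↑ˡ s) ⟧
    uR = ∑[ j < s ] ⟦ unmatched M (s ↑ʳ j) ⟧

    freeʳ : ∀ j → free M excused root (s ↑ʳ j) ≡ unmatched M (s ↑ʳ j)
    freeʳ j = free-≢ M (λ e → ↑ˡ≢↑ʳ zero j (sym e)) excused

    rootAccount : fL + ⟦ excused ⟧ ≡ ∑[ i < s ] ⟦ unmatched M (i ↑ˡ s) ⟧
    rootAccount = begin-equality
      ⟦ free M excused root root ⟧ + rest + ⟦ excused ⟧
        ≡⟨ swap ⟦ free M excused root root ⟧ rest ⟦ excused ⟧ ⟩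
      ⟦ free M excused root root ⟧ + ⟦ excused ⟧ + rest
        ≡⟨ cong₂ _+_ (free-root M root excused root-unmatched) (sum-cong-≗ (λ i → cong ⟦_⟧ (free-suc i))) ⟩
      ∑[ i < s ] ⟦ unmatched M (i ↑ˡ s) ⟧ ∎
      where
      rest = ∑[ i < s′ ] ⟦ free M excused root (suc i ↑ˡ s) ⟧
      swap : ∀ a b c → a + b + c ≡ a + c + b
      swap = solve-∀
      0≢suc : ∀ {i : Fin s′} → zero ≢ suc i
      0≢suc ()
      free-suc : ∀ i → free M excused root (suc i ↑ˡ s) ≡ unmatched M (suc i ↑ˡ s)
      free-suc i = free-≢ M (λ e → 0≢suc (↑ˡ-injective s zero (suc i) (sym e))) excused

    noFreePair : fL ≡ 0 ⊎ uR ≡ 0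
    noFreePair with fL in fL≡ | uR in uR≡
    ... | zero  | _     = inj₁ refl
    ... | suc _ | zero  = inj₂ refl
    ... | suc _ | suc _ =
      let i , i-free = ∑⟦⟧>0⇒∃ (λ i → free M excused root (i ↑ˡ s)) (subst (0 <_) (sym fL≡) (s≤s z≤n))
          j , j-free = ∑⟦⟧>0⇒∃ (λ j → unmatched M (s ↑ʳ j)) (subst (0 <_) (sym uR≡) (s≤s z≤n))
      in ⊥-elim (independent (i ↑ˡ s) (s ↑ʳ j) (adj-ˡʳ i j) i-free (trans (freeʳ j) j-free))

    settle : ∀ f u e → f + e ≡ u → f ≡ 0 ⊎ u ≡ 0 → f + u ≤ e
    settle _ u e eq  (inj₁ refl) = ≤-reflexive (sym eq)
    settle f _ e eq  (inj₂ refl) = subst (_≤ e) (sym (trans (+-identityʳ f) (m+n≡0⇒m≡0 f eq))) z≤n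

  crossingEdge : ∀ u v → adj G u v ≡ true → ∃₂ λ (i j : Fin s) → SameEdge u v (i ↑ˡ s) (s ↑ʳ j)
  crossingEdge u v uv with side s s u | side s s v
  ... | left i  | right j = i , j , inj₁ (refl , refl)
  ... | right j | left i  = i , j , inj₂ (refl , refl)
  ... | left i  | left j  = ⊥-elim (true≢false (trans (sym uv) (combine-ˡˡ {s} {s} emptyEdges emptyEdges _ i j)))
  ... | right i | right j = ⊥-elim (true≢false (trans (sym uv) (combine-ʳʳ {s} {s} emptyEdges emptyEdges _ i j)))

  linked : EdgesPairwiseLinked G
  linked u v x y uv xy _ with crossingEdge u v uv | crossingEdge x y xy
  ... | i , _ , same | _ , j , same′ =
    i ↑ˡ s , s ↑ʳ j , adj-ˡʳ i j , inj₁ (SameEdge-endpointˡ same) , inj₂ (SameEdge-endpointʳ same′)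

  connected : Connected G
  connected = connected-via root toRoot
    where
    rightToRoot : ∀ j → Reach G (s ↑ʳ j) root
    rightToRoot j = step (trans (Graph.sym G (s ↑ʳ j) root) (adj-ˡʳ zero j)) here
    toRoot : ∀ u → Reach G u root
    toRoot u with side s s u
    ... | left i  = step (adj-ˡʳ i zero) (rightToRoot zero)
    ... | right j = rightToRoot j

  degreeSum-adj : degreeSum (adj G) ≡ 2 * (s * s)
  degreeSum-adj = begin
    degreeSum (adj G)
      ≡⟨ degreeSum-combine {s} {s} emptyEdges emptyEdges (λ _ _ → true) (λ _ _ → refl) (λ _ _ → refl) ⟩
    degreeSum (emptyEdges {s}) + degreeSum (emptyEdges {s}) + 2 * ∑[ i < s ] ∑[ j < s ] 1
      ≡⟨ cong₂ (λ a b → a + b + 2 * ∑[ i < s ] ∑[ j < s ] 1) (degreeSum-empty {s}) (degreeSum-empty {s}) ⟩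
    2 * ∑[ i < s ] ∑[ j < s ] 1
      ≡⟨ cong (2 *_) (trans (sum-cong-≗ {s} (λ _ → trans (∑-const s 1) (*-identityʳ s))) (∑-const s s)) ⟩
    2 * (s * s) ∎
    where open ≡-Reasoning

  rungs-unmatched : ∀ v → unmatched (rungs s) v ≡ false
  rungs-unmatched v = cong (_≡ᵇ 0) (degree-rungs {s} v)

  rungs-matchingG : IsMatching G (rungs s)
  rungs-matchingG = rungs-matching G (λ i → adj-ˡʳ i i)

biclique : ℕ → Gadget
biclique s′ = record
  { order = s + s ; graph = G ; root = root
  ; size = s * s ; match = s ; minMatch = s ; deficiency = 0
  ; degreeSum≡ = degreeSum-adj
  ; connected = connected
  ; order≡match = cong (s +_) (sym (+-identityʳ s))
  ; order≡minMatch = trans (cong (s +_) (sym (+-identityʳ s))) (sym (+-identityʳ (2 * s)))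
  ; perfectMatching = rungs s , rungs-matchingG , degreeSum-rungs {s}
  ; sparseMaximal = rungs s , rungs-matchingG , rungs-unmatched root ,
                    (λ a _ _ a-free _ → true≢false (trans (sym a-free) (rungs-unmatched a))) ,
                    trans (degreeSum-rungs {s}) (cong (s +_) (sym (+-identityʳ s)))
  ; freeBound = freeBound
  ; inducedAtMost1 = linked⇒inducedMatchingsAtMost1 G linked
  ; rootSeesEveryEdge = λ a b ab _ _ → let i , j , same = crossingEdge a b ab
                                      in s ↑ʳ j , adj-ˡʳ zero j , SameEdge-endpointʳ same
  ; someEdge = root , s ↑ʳ zero , adj-ˡʳ zero zero
  }
  where open Biclique s′

degreeSum-clique : ∀ n → degreeSum (adj (clique n)) + n ≡ n * n
degreeSum-clique n = begin
  degreeSum (adj (clique n)) + n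
    ≡⟨ cong (degreeSum (adj (clique n)) +_) (sym (trans (sum-cong-≗ {n} ∑-==ˡ) (trans (∑-const n 1) (*-identityʳ n)))) ⟩
  ∑[ i < n ] ∑[ j < n ] ⟦ not (i == j) ⟧ + ∑[ i < n ] ∑[ j < n ] ⟦ i == j ⟧
    ≡⟨ sym (∑-distrib-+ {n} (λ i → ∑[ j < n ] ⟦ not (i == j) ⟧) (λ i → ∑[ j < n ] ⟦ i == j ⟧)) ⟩
  ∑[ i < n ] (∑[ j < n ] ⟦ not (i == j) ⟧ + ∑[ j < n ] ⟦ i == j ⟧)
    ≡⟨ sum-cong-≗ {n} (λ i → sym (∑-distrib-+ {n} (λ j → ⟦ not (i == j) ⟧) (λ j → ⟦ i == j ⟧))) ⟩
  ∑[ i < n ] ∑[ j < n ] (⟦ not (i == j) ⟧ + ⟦ i == j ⟧)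
    ≡⟨ sum-cong-≗ {n} (λ i → sum-cong-≗ {n} (λ j → complementary (i == j))) ⟩
  ∑[ i < n ] ∑[ j < n ] 1
    ≡⟨ trans (sum-cong-≗ {n} (λ _ → trans (∑-const n 1) (*-identityʳ n))) (∑-const n n) ⟩
  n * n ∎
  where
  open ≡-Reasoning
  complementary : ∀ b → ⟦ not b ⟧ + ⟦ b ⟧ ≡ 1
  complementary true  = refl
  complementary false = refl

C2-suc : ∀ n → suc n C 2 ≡ n + n C 2
C2-suc n = trans (sym (nCk+nC[k+1]≡[n+1]C[k+1] n 1)) (cong (_+ n C 2) (nC1≡n n))

2*[1+n]C2 : ∀ n → 2 * (suc n C 2) ≡ n * n + n
2*[1+n]C2 zero    = refl
2*[1+n]C2 (suc n) = begin
  2 * (suc (suc n) C 2)         ≡⟨ cong (2 *_) (C2-suc (suc n)) ⟩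
  2 * (suc n + suc n C 2)       ≡⟨ *-distribˡ-+ 2 (suc n) (suc n C 2) ⟩
  2 * suc n + 2 * (suc n C 2)   ≡⟨ cong (2 * suc n +_) (2*[1+n]C2 n) ⟩
  2 * suc n + (n * n + n)       ≡⟨ square-step n ⟩
  suc n * suc n + suc n         ∎
  where
  open ≡-Reasoning
  square-step : ∀ n → 2 * (1 + n) + (n * n + n) ≡ (1 + n) * (1 + n) + (1 + n)
  square-step = solve-∀

-- The clique K_m with a pendant vertex m ↑ʳ i attached to each clique vertex i ↑ˡ m, where m = 2 (t′ + 1).
module Corona (t′ : ℕ) where
  t m : ℕ
  t = suc t′
  m = t + t

  G : Graph (m + m)
  G = combineGraph (clique m) (emptyGraph m) _==_

  root : Fin (m + m)
  root = zero ↑ˡ m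

  adj-ˡˡ : ∀ i j → adj G (i ↑ˡ m) (j ↑ˡ m) ≡ not (i == j)
  adj-ˡˡ = combine-ˡˡ (adj (clique m)) emptyEdges _==_

  adj-ʳʳ : ∀ i j → adj G (m ↑ʳ i) (m ↑ʳ j) ≡ false
  adj-ʳʳ = combine-ʳʳ (adj (clique m)) emptyEdges _==_

  adj-ˡʳ : ∀ i j → adj G (i ↑ˡ m) (m ↑ʳ j) ≡ (i == j)
  adj-ˡʳ = combine-ˡʳ (adj (clique m)) emptyEdges _==_

  adj-ʳˡ : ∀ i j → adj G (m ↑ʳ i) (j ↑ˡ m) ≡ (j == i)
  adj-ʳˡ = combine-ʳˡ (adj (clique m)) emptyEdges _==_

  pendant : ∀ i → adj G (i ↑ˡ m) (m ↑ʳ i) ≡ true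
  pendant i = trans (adj-ˡʳ i i) (==-refl i)

  clique-adj : ∀ {i j : Fin m} → i ≢ j → adj G (i ↑ˡ m) (j ↑ˡ m) ≡ true
  clique-adj {i} {j} i≢j = trans (adj-ˡˡ i j) (cong not (≢⇒==false i≢j))

  cliqueEndpoint : ∀ u v → adj G u v ≡ true → ∃[ k ] (k ↑ˡ m ≡ u ⊎ k ↑ˡ m ≡ v)
  cliqueEndpoint u v uv with side m m u | side m m v
  ... | left i  | _       = i , inj₁ refl
  ... | right _ | left j  = j , inj₂ refl
  ... | right i | right j = ⊥-elim (true≢false (trans (sym uv) (adj-ʳʳ i j)))

  linked : EdgesPairwiseLinked G
  linked u v x y uv xy _ with cliqueEndpoint u v uv | cliqueEndpoint x y xy
  ... | k , k∈uv | l , l∈xy with k ≟ l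
  ...   | yes refl = u , v , uv , inj₁ (inj₁ refl) , shared k∈uv l∈xy
    where
    shared : ∀ {z} → (z ≡ u ⊎ z ≡ v) → (z ≡ x ⊎ z ≡ y) → Meets u v x y
    shared (inj₁ refl) z∈xy = inj₁ z∈xy
    shared (inj₂ refl) z∈xy = inj₂ z∈xy
  ...   | no k≢l   = k ↑ˡ m , l ↑ˡ m , clique-adj k≢l , inj₁ k∈uv , inj₂ l∈xy

  connected : Connected G
  connected = connected-via root toRoot
    where
    cliqueToRoot : ∀ i → Reach G (i ↑ˡ m) root
    cliqueToRoot i with i ≟ zero
    ... | yes refl = here
    ... | no i≢0   = step (clique-adj i≢0) here
    toRoot : ∀ u → Reach G u root
    toRoot u with side m m u
    ... | left i  = cliqueToRoot i
    ... | right j = step (trans (Graph.sym G (m ↑ʳ j) (j ↑ˡ m)) (pendant j)) (cliqueToRoot j)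

  degreeSum-adj : degreeSum (adj G) ≡ 2 * (suc m C 2)
  degreeSum-adj = begin
    degreeSum (adj G)
      ≡⟨ degreeSum-combine (adj (clique m)) emptyEdges _==_ (Graph.sym (clique m)) (λ _ _ → refl) ⟩
    degreeSum (adj (clique m)) + degreeSum (emptyEdges {m}) + 2 * ∑[ i < m ] ∑[ j < m ] ⟦ i == j ⟧
      ≡⟨ cong₂ (λ a b → degreeSum (adj (clique m)) + a + 2 * b) (degreeSum-empty {m})
               (trans (sum-cong-≗ {m} ∑-==ˡ) (trans (∑-const m 1) (*-identityʳ m))) ⟩
    degreeSum (adj (clique m)) + 0 + 2 * m
      ≡⟨ rearrange (degreeSum (adj (clique m))) m ⟩
    (degreeSum (adj (clique m)) + m) + m
      ≡⟨ cong (_+ m) (degreeSum-clique m) ⟩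
    m * m + m
      ≡⟨ sym (2*[1+n]C2 m) ⟩
    2 * (suc m C 2) ∎
    where
    open ≡-Reasoning
    rearrange : ∀ a m → a + 0 + 2 * m ≡ (a + m) + m
    rearrange = solve-∀

  -- A free clique vertex would leave its pendant, whose only neighbour it is, free as well.
  freeBound : FreeBound G root (λ excused → ⟦ excused ⟧ + m)
  freeBound M excused mM root-unmatched independent = begin
    ∑[ v < m + m ] ⟦ free M excused root v ⟧
      ≡⟨ ∑-++ {m} {m} (λ v → ⟦ free M excused root v ⟧) ⟩
    ∑[ i < m ] ⟦ free M excused root (i ↑ˡ m) ⟧ + ∑[ j < m ] ⟦ free M excused root (m ↑ʳ j) ⟧
      ≤⟨ +-mono-≤ (≤-reflexive (∑-zero {m} (cong ⟦_⟧ ∘ clique-notFree)))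
                  (∑-mono {m} (λ j → ⟦⟧≤1 (free M excused root (m ↑ʳ j)))) ⟩
    0 + ∑[ j < m ] 1
      ≡⟨ trans (∑-const m 1) (*-identityʳ m) ⟩
    m
      ≤⟨ m≤n+m m ⟦ excused ⟧ ⟩
    ⟦ excused ⟧ + m ∎
    where
    open ≤-Reasoning
    module M = Matching G M mM
    clique-notFree : ∀ i → free M excused root (i ↑ˡ m) ≡ false
    clique-notFree i = ¬-not λ i-free → independent (i ↑ˡ m) (m ↑ʳ i) (pendant i) i-free (pendant-free i-free)
      where
      noPendantEdge : free M excused root (i ↑ˡ m) ≡ true → ∀ v → M (m ↑ʳ i) v ≡ false
      noPendantEdge i-free v with M (m ↑ʳ i) v in Miv
      ... | false = refl
      ... | true with side m m v
      ...   | right j = ⊥-elim (true≢false (trans (sym (M.⊆adj _ _ Miv)) (adj-ʳʳ i j)))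
      ...   | left j with ==⇒≡ {i = j} (trans (sym (adj-ʳˡ i j)) (M.⊆adj _ _ Miv))
      ...     | refl = ⊥-elim (true≢false (trans (sym (∧-conicalˡ (unmatched M (i ↑ˡ m)) _ i-free))
                                   (edge⇒matched M (i ↑ˡ m) (m ↑ʳ i) (trans (M.symmetric _ _) Miv))))
      pendant-free : free M excused root (i ↑ˡ m) ≡ true → free M excused root (m ↑ʳ i) ≡ true
      pendant-free i-free = trans (free-≢ M (λ e → ↑ˡ≢↑ʳ zero i (sym e)) excused)
                           (cong (_≡ᵇ 0) (∑-zero {m + m} (λ v → cong ⟦_⟧ (noPendantEdge i-free v))))

  sparse : EdgeSet (m + m)
  sparse = rungs t ⊕ emptyEdges

  rungs-matchingᶜ : IsMatching (clique m) (rungs t)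
  rungs-matchingᶜ = rungs-matching {t} (clique m) (λ i → cong not (≢⇒==false (↑ˡ≢↑ʳ i i)))

  sparse-matching : IsMatching G sparse
  sparse-matching = ⊕-matching (clique m) (emptyGraph m) _==_ rungs-matchingᶜ (empty-matching (emptyGraph m))

  sparse-matchedˡ : ∀ i → unmatched sparse (i ↑ˡ m) ≡ false
  sparse-matchedˡ i = cong (_≡ᵇ 0) (trans (degree-⊕ˡ {MH = emptyEdges {m}} i) (degree-rungs {t} i))

  sparse-independent : UnmatchedIndependent G sparse
  sparse-independent a b ab a-free b-free with side m m a | side m m b
  ... | left i  | _       = true≢false (trans (sym a-free) (sparse-matchedˡ i))
  ... | right _ | left j  = true≢false (trans (sym b-free) (sparse-matchedˡ j))
  ... | right i | right j = true≢false (trans (sym ab) (adj-ʳʳ i j))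

  degreeSum-sparse : degreeSum sparse ≡ 2 * t
  degreeSum-sparse =
    trans (degreeSum-⊕ (Matching.symmetric (clique m) (rungs t) rungs-matchingᶜ) (λ _ _ → refl))
          (trans (cong₂ _+_ (degreeSum-rungs {t}) (degreeSum-empty {m})) (+-assoc t t 0))

corona : ℕ → Gadget
corona t′ = record
  { order = m + m ; graph = G ; root = root
  ; size = suc m C 2 ; match = m ; minMatch = t ; deficiency = m
  ; degreeSum≡ = degreeSum-adj
  ; connected = connected
  ; order≡match = cong (m +_) (sym (+-identityʳ m))
  ; order≡minMatch = cong (λ k → k + m) (cong (t +_) (sym (+-identityʳ t)))
  ; perfectMatching = rungs m , rungs-matching G pendant , degreeSum-rungs {m}
  ; sparseMaximal = sparse , sparse-matching , sparse-matchedˡ zero , sparse-independent , degreeSum-sparse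
  ; freeBound = freeBound
  ; inducedAtMost1 = linked⇒inducedMatchingsAtMost1 G linked
  ; rootSeesEveryEdge = rootSees
  ; someEdge = root , m ↑ʳ zero , pendant zero
  }
  where
  open Corona t′
  rootSees : RootSeesEveryEdge G root
  rootSees a b ab a≢root b≢root with cliqueEndpoint a b ab
  ... | k , k∈ab = k ↑ˡ m , clique-adj (λ 0≡k → Sum.[ (λ e → a≢root (trans (sym e) (cong (_↑ˡ m) (sym 0≡k))))
                                                      , (λ e → b≢root (trans (sym e) (cong (_↑ˡ m) (sym 0≡k)))) ] k∈ab)
                 , k∈ab

open Gadget using (order; graph; root; size; match; minMatch; deficiency)

-- Stars of gadgets

-- Sums over the list in reverse, so that `star` below needs no transport along + rearrangements.
total : (Gadget → ℕ) → List Gadget → ℕ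
total f []       = 0
total f (g ∷ gs) = total f gs + f g

centre : (gs : List Gadget) → Fin (suc (total order gs))
centre []       = zero
centre (g ∷ gs) = centre gs ↑ˡ order g

star : (gs : List Gadget) → Graph (suc (total order gs))
star []       = emptyGraph 1
star (g ∷ gs) = attach (star gs) (centre gs) (graph g) (root g)

star-connected : ∀ gs → Connected (star gs)
star-connected []       zero zero = here
star-connected (g ∷ gs) =
  Attach.connected (star gs) (centre gs) (graph g) (root g) (star-connected gs) (Gadget.connected g)

star-degreeSum : ∀ gs → degreeSum (adj (star gs)) ≡ 2 * total (λ g → suc (size g)) gs
star-degreeSum []       = degreeSum-empty {1}
star-degreeSum (g ∷ gs) = begin
  degreeSum (adj (star (g ∷ gs)))
    ≡⟨ Attach.degreeSum-adj (star gs) (centre gs) (graph g) (root g) ⟩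
  degreeSum (adj (star gs)) + degreeSum (adj (graph g)) + 2
    ≡⟨ cong₂ (λ a b → a + b + 2) (star-degreeSum gs) (Gadget.degreeSum≡ g) ⟩
  2 * total (λ g → suc (size g)) gs + 2 * size g + 2
    ≡⟨ distrib (total (λ g → suc (size g)) gs) (size g) ⟩
  2 * total (λ g → suc (size g)) (g ∷ gs) ∎
  where
  open ≡-Reasoning
  distrib : ∀ a b → 2 * a + 2 * b + 2 ≡ 2 * (a + suc b)
  distrib = solve-∀

star-freeBound : ∀ gs → FreeBound (star gs) (centre gs) (λ excused → ⟦ not excused ⟧ + total deficiency gs)
star-freeBound []       M false _ _ _ = +-mono-≤ (⟦⟧≤1 (free M false zero zero)) z≤n
star-freeBound []       M true  _ _ _ = ≤-reflexive (cong (λ b → ⟦ b ⟧ + 0) (∧-zeroʳ (unmatched M zero)))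
star-freeBound (g ∷ gs) =
  Attach.freeBound (star gs) (centre gs) (graph g) (root g) {total deficiency gs} {deficiency g}
    (star-freeBound gs) (Gadget.freeBound g)

star-inducedBound : ∀ gs → InducedMatchingsAtMost (star gs) (total (λ _ → 1) gs)
star-inducedBound []       M (m , _) =
  ≤-reflexive (cong (λ b → ⟦ b ⟧ + 0 + 0) (Matching.irreflexive (star []) M m zero))
star-inducedBound (g ∷ gs) =
  Attach.inducedBound (star gs) (centre gs) (graph g) (root g) {total (λ _ → 1) gs}
    (star-inducedBound gs) (Gadget.inducedAtMost1 g) (Gadget.rootSeesEveryEdge g)

module _ (g : Gadget) (gs : List Gadget) {M : EdgeSet (suc (total order gs))} {Mg : EdgeSet (order g)}
         (m : IsMatching (star gs) M) (mg : IsMatching (graph g) Mg) where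

  extend-matching : IsMatching (star (g ∷ gs)) (M ⊕ Mg)
  extend-matching = ⊕-matching (star gs) (graph g) _ m mg

  extend-degreeSum : degreeSum (M ⊕ Mg) ≡ degreeSum M + degreeSum Mg
  extend-degreeSum = degreeSum-⊕ (Matching.symmetric (star gs) M m) (Matching.symmetric (graph g) Mg mg)

  extend-centre : degree M (centre gs) ≡ 0 → degree (M ⊕ Mg) (centre (g ∷ gs)) ≡ 0
  extend-centre = trans (degree-⊕ˡ {MH = Mg} (centre gs))

star-perfect : ∀ gs → Σ (EdgeSet (suc (total order gs))) λ M →
               IsMatching (star gs) M × degree M (centre gs) ≡ 0 × degreeSum M ≡ total order gs
star-perfect []       = emptyEdges , empty-matching (star []) , refl , refl
star-perfect (g ∷ gs) with star-perfect gs | Gadget.perfectMatching g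
... | M , m , centre-free , D≡ | Mg , mg , Dg≡ =
  M ⊕ Mg , extend-matching g gs m mg , extend-centre g gs m mg centre-free ,
  trans (extend-degreeSum g gs m mg) (cong₂ _+_ D≡ Dg≡)

star-sparse : ∀ gs → Σ (EdgeSet (suc (total order gs))) λ M →
              IsMatching (star gs) M × degree M (centre gs) ≡ 0 × UnmatchedIndependent (star gs) M ×
              degreeSum M ≡ 2 * total minMatch gs
star-sparse []       = emptyEdges , empty-matching (star []) , refl , (λ _ _ ()) , refl
star-sparse (g ∷ gs) with star-sparse gs | Gadget.sparseMaximal g
... | M , m , centre-free , independent , D≡ | Mg , mg , root-matched , independentg , Dg≡ =
  M ⊕ Mg , extend-matching g gs m mg , extend-centre g gs m mg centre-free ,
  Attach.⊕-unmatchedIndependent (star gs) (centre gs) (graph g) (root g) m mg independent independentg root-matched ,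
  trans (extend-degreeSum g gs m mg)
        (trans (cong₂ _+_ D≡ Dg≡) (sym (*-distribˡ-+ 2 (total minMatch gs) (minMatch g))))

star-induced : ∀ gs → Σ (EdgeSet (suc (total order gs))) λ M →
               IsInducedMatching (star gs) M × degree M (centre gs) ≡ 0 × degreeSum M ≡ 2 * total (λ _ → 1) gs
star-induced []       = emptyEdges , empty-induced (star []) , refl , refl
star-induced (g ∷ gs) with star-induced gs | Gadget.someEdge g
... | M , induced , centre-free , D≡ | a , b , ab =
  M ⊕ singleEdge a b ,
  Attach.⊕-induced (star gs) (centre gs) (graph g) (root g) (proj₁ induced) (singleEdge-matching (graph g) ab)
    induced centre-free (singleEdge-induced (graph g) ab) ,
  extend-centre g gs (proj₁ induced) (singleEdge-matching (graph g) ab) centre-free ,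
  trans (extend-degreeSum g gs (proj₁ induced) (singleEdge-matching (graph g) ab))
        (trans (cong₂ _+_ D≡ (degreeSum-singleEdge (graph g) ab)) (sym (*-distribˡ-+ 2 (total (λ _ → 1) gs) 1)))

total-order≡match : ∀ gs → total order gs ≡ 2 * total match gs
total-order≡match []       = refl
total-order≡match (g ∷ gs) = trans (cong₂ _+_ (total-order≡match gs) (Gadget.order≡match g))
                                   (sym (*-distribˡ-+ 2 (total match gs) (match g)))

total-order≡minMatch : ∀ gs → total order gs ≡ 2 * total minMatch gs + total deficiency gs
total-order≡minMatch []       = refl
total-order≡minMatch (g ∷ gs) = trans (cong₂ _+_ (total-order≡minMatch gs) (Gadget.order≡minMatch g))
                                      (regroup (total minMatch gs) (total deficiency gs) (minMatch g) (deficiency g))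
  where
  regroup : ∀ a b c d → (2 * a + b) + (2 * c + d) ≡ 2 * (a + c) + (b + d)
  regroup = solve-∀

2*m≤1+2*n⇒m≤n : ∀ {m n} → 2 * m ≤ suc (2 * n) → m ≤ n
2*m≤1+2*n⇒m≤n {m} {n} le = ≤-pred (*-cancelˡ-< 2 m (suc n) (subst (2 * m <_) (sym (*-suc 2 n)) (s≤s le)))

module _ (gs : List Gadget) where
  private
    N = total order gs
    G = star gs

    half≡ : ∀ {M} → IsMatching G M → ∀ {k} → degreeSum M ≡ 2 * k → edgeCount M ≡ k
    half≡ {M} m D≡ = *-cancelˡ-≡ (edgeCount M) _ 2 (trans (sym (Matching.degreeSum≡2*edgeCount G M m)) D≡)

    unmatched-count : ∀ {M} → IsMatching G M → degreeSum M + ∑[ v < suc N ] ⟦ unmatched M v ⟧ ≡ suc N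
    unmatched-count {M} m = Matching.degreeSum+unmatched≡n G M m

  star-indMatch : IndMatchNumber G (total (λ _ → 1) gs)
  star-indMatch =
    let M , induced , _ , D≡ = star-induced gs
    in (M , induced , half≡ (proj₁ induced) D≡) ,
       λ M′ induced′ → *-cancelˡ-≤ 2 (subst (_≤ 2 * total (λ _ → 1) gs)
                                           (Matching.degreeSum≡2*edgeCount G M′ (proj₁ induced′))
                                           (star-inducedBound gs M′ induced′))

  star-match : MatchNumber G (total match gs)
  star-match =
    let M , m , _ , D≡ = star-perfect gs
    in (M , m , half≡ m (trans D≡ (total-order≡match gs))) ,
       λ M′ m′ → 2*m≤1+2*n⇒m≤n (begin
         2 * edgeCount M′   ≡⟨ Matching.degreeSum≡2*edgeCount G M′ m′ ⟨
         degreeSum M′       ≤⟨ m+n≤o⇒m≤o (degreeSum M′) (≤-reflexive (unmatched-count m′)) ⟩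
         suc N              ≡⟨ cong suc (total-order≡match gs) ⟩
         suc (2 * total match gs) ∎)
    where open ≤-Reasoning

  -- Free vertices of a maximal matching are independent, so at most 1 + Σ deficiency of them remain.
  star-minMatch : MinMatchNumber G (total minMatch gs)
  star-minMatch =
    let M , m , _ , independent , D≡ = star-sparse gs
    in (M , unmatchedIndependent⇒maximal {G = G} m independent , half≡ m D≡) ,
       λ M′ maximal′ → *-cancelˡ-≤ 2 (lowerBound M′ maximal′)
    where
    open ≤-Reasoning
    lowerBound : ∀ M′ → IsMaximalMatching G M′ → 2 * total minMatch gs ≤ 2 * edgeCount M′
    lowerBound M′ (m′ , maximal) = +-cancelʳ-≤ (suc (total deficiency gs)) _ _ (begin
      2 * total minMatch gs + suc (total deficiency gs)
        ≡⟨ +-suc _ _ ⟩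
      suc (2 * total minMatch gs + total deficiency gs)
        ≡⟨ cong suc (total-order≡minMatch gs) ⟨
      suc N
        ≡⟨ unmatched-count m′ ⟨
      degreeSum M′ + ∑[ v < suc N ] ⟦ unmatched M′ v ⟧
        ≤⟨ +-monoʳ-≤ (degreeSum M′) (freeBound⇒unmatchedBound {G = G} (star-freeBound gs) m′
                                        (maximal⇒unmatchedIndependent {G = G} (m′ , maximal))) ⟩
      degreeSum M′ + suc (total deficiency gs)
        ≡⟨ cong (_+ suc (total deficiency gs)) (Matching.degreeSum≡2*edgeCount G M′ m′) ⟩
      2 * edgeCount M′ + suc (total deficiency gs) ∎)

  star-numEdges : numEdges G ≡ total (λ g → suc (size g)) gs
  star-numEdges = *-cancelˡ-≡ (numEdges G) _ 2
    (trans (sym (handshake (adj G) (Graph.sym G) (irrefl G))) (star-degreeSum gs))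

  star-realises : MinEdgesAtMost (total (λ _ → 1) gs) (total minMatch gs) (total match gs)
                                 (total (λ g → suc (size g)) gs)
  star-realises = suc N , G , star-connected gs , star-indMatch , star-minMatch , star-match , ≤-reflexive star-numEdges

open Gadget using (order; size; match; minMatch)

-- The three constructions

total-++ : ∀ f xs ys → total f (xs ++ ys) ≡ total f xs + total f ys
total-++ f []       ys = refl
total-++ f (g ∷ xs) ys = trans (cong (_+ f g) (total-++ f xs ys)) (swap (total f xs) (total f ys) (f g))
  where
  swap : ∀ a b c → a + b + c ≡ a + c + b
  swap = solve-∀

total-replicate : ∀ f n g → total f (replicate n g) ≡ n * f g
total-replicate f zero    g = refl
total-replicate f (suc n) g = trans (cong (_+ f g) (total-replicate f n g)) (+-comm (n * f g) (f g))

total-two : ∀ f m g n h → total f (replicate m g ++ replicate n h) ≡ m * f g + n * f h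
total-two f m g n h = trans (total-++ f (replicate m g) _) (cong₂ _+_ (total-replicate f m g) (total-replicate f n h))

total-three : ∀ f l g m h n i →
              total f (replicate l g ++ replicate m h ++ replicate n i) ≡ l * f g + (m * f h + n * f i)
total-three f l g m h n i = trans (total-++ f (replicate l g) _) (cong₂ _+_ (total-replicate f l g) (total-two f m h n i))

realise : ∀ gs {p q r B} → total (λ _ → 1) gs ≡ p → total minMatch gs ≡ q → total match gs ≡ r →
          total (λ g → suc (size g)) gs ≡ B → MinEdgesAtMost p q r B
realise gs refl refl refl refl = star-realises gs

quotient-nonzero : ∀ {n a b} → n ≤ a * n + b → b < n → ∃[ a′ ] a ≡ suc a′
quotient-nonzero {a = zero}   n≤b b<n = ⊥-elim (<-irrefl refl (<-≤-trans b<n n≤b))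
quotient-nonzero {a = suc a′} _   _   = a′ , refl

bicliqueStar : ∀ a d b → MinEdgesAtMost (b + d) (suc a * (b + d) + b) (suc a * (b + d) + b)
                                        ((suc a ^ 2 + 1) * (b + d) + (2 * suc a + 1) * b)
bicliqueStar a d b = realise gs (trans (totals (λ _ → 1)) (count d b)) (trans (totals minMatch) (matched a d b))
                                (trans (totals match) (matched a d b)) (trans (totals (λ g → suc (size g))) (edges a d b))
  where
  gs = replicate d (biclique a) ++ replicate b (biclique (suc a))
  totals = λ f → total-two f d (biclique a) b (biclique (suc a))
  count : ∀ d b → d * 1 + b * 1 ≡ b + d
  count = solve-∀
  matched : ∀ a d b → d * (1 + a) + b * (2 + a) ≡ (1 + a) * (b + d) + b
  matched = solve-∀
  edges : ∀ a d b → d * (1 + (1 + a) * (1 + a)) + b * (1 + (2 + a) * (2 + a)) ≡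
                    ((1 + a) * ((1 + a) * 1) + 1) * (b + d) + (2 * (1 + a) + 1) * b
  edges = solve-∀

mixedStar : ∀ a d b k → MinEdgesAtMost (suc (b + d)) (suc a * (b + d) + b + suc k) (suc a * (b + d) + b + suc k + suc k)
                          (suc a ^ 2 * (b + d) + (2 * suc a + 1) * b + suc (b + d) + ((2 * suc k + 1) C 2))
mixedStar a d b k = realise gs (trans (totals (λ _ → 1)) (count d b)) (trans (totals minMatch) (minMatched a d b k))
  (trans (totals match) (matched a d b k))
  (trans (totals (λ g → suc (size g))) (trans (edges a d b _) (cong (_ +_) (cong (_C 2) (pendants k)))))
  where
  gs = replicate d (biclique a) ++ replicate b (biclique (suc a)) ++ replicate 1 (corona k)
  totals = λ f → total-three f d (biclique a) b (biclique (suc a)) 1 (corona k)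
  count : ∀ d b → d * 1 + (b * 1 + 1 * 1) ≡ 1 + (b + d)
  count = solve-∀
  minMatched : ∀ a d b k → d * (1 + a) + (b * (2 + a) + 1 * (1 + k)) ≡ (1 + a) * (b + d) + b + (1 + k)
  minMatched = solve-∀
  matched : ∀ a d b k → d * (1 + a) + (b * (2 + a) + 1 * ((1 + k) + (1 + k))) ≡
                        (1 + a) * (b + d) + b + (1 + k) + (1 + k)
  matched = solve-∀
  edges : ∀ a d b X → d * (1 + (1 + a) * (1 + a)) + (b * (1 + (2 + a) * (2 + a)) + 1 * (1 + X)) ≡
                      (1 + a) * ((1 + a) * 1) * (b + d) + (2 * (1 + a) + 1) * b + (1 + (b + d)) + X
  edges = solve-∀
  pendants : ∀ k → 1 + ((1 + k) + (1 + k)) ≡ 2 * (1 + k) + 1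
  pendants = solve-∀

C2-suc² : ∀ n → suc (suc n) C 2 ≡ suc n + (n + n C 2)
C2-suc² n = trans (C2-suc (suc n)) (cong (suc n +_) (C2-suc n))

coronaStar : ∀ a d b w →
  MinEdgesAtMost (w + (b + d)) (w + (suc a * (b + d) + b)) (w + (suc a * (b + d) + b) + (suc a * (b + d) + b))
                 (w + (b + d) + w + (b + d) * ((2 * suc a + 1) C 2) + b * (4 * suc a + 3))
coronaStar a d b w = realise gs (trans (totals (λ _ → 1)) (count w d b)) (trans (totals minMatch) (minMatched a d b w))
                                (trans (totals match) (matched a d b w)) (trans (totals (λ g → suc (size g))) edges≡)
  where
  gs = replicate w (biclique 0) ++ replicate d (corona a) ++ replicate b (corona (suc a))
  totals = λ f → total-three f w (biclique 0) d (corona a) b (corona (suc a))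
  count : ∀ w d b → w * 1 + (d * 1 + b * 1) ≡ w + (b + d)
  count = solve-∀
  minMatched : ∀ a d b w → w * 1 + (d * (1 + a) + b * (2 + a)) ≡ w + ((1 + a) * (b + d) + b)
  minMatched = solve-∀
  matched : ∀ a d b w → w * 1 + (d * ((1 + a) + (1 + a)) + b * ((2 + a) + (2 + a))) ≡
                        w + ((1 + a) * (b + d) + b) + ((1 + a) * (b + d) + b)
  matched = solve-∀
  A = suc a
  X = suc (A + A) C 2
  larger : suc (suc A + suc A) C 2 ≡ X + (4 * A + 3)
  larger = trans (cong (λ t → suc (suc t) C 2) (+-suc A A)) (trans (C2-suc² (suc (A + A))) (regroup a X))
    where
    regroup : ∀ a X → (2 + ((1 + a) + (1 + a))) + ((1 + ((1 + a) + (1 + a))) + X) ≡ X + (4 * (1 + a) + 3)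
    regroup = solve-∀
  edges≡ : w * 2 + (d * suc X + b * suc (suc (suc A + suc A) C 2)) ≡
           w + (b + d) + w + (b + d) * ((2 * A + 1) C 2) + b * (4 * A + 3)
  edges≡ = begin
    w * 2 + (d * suc X + b * suc (suc (suc A + suc A) C 2))
      ≡⟨ cong (λ Z → w * 2 + (d * suc X + b * suc Z)) larger ⟩
    w * 2 + (d * suc X + b * suc (X + (4 * A + 3)))
      ≡⟨ regroup a d b w X ⟩
    w + (b + d) + w + (b + d) * X + b * (4 * A + 3)
      ≡⟨ cong (λ Y → w + (b + d) + w + (b + d) * Y + b * (4 * A + 3)) (cong (_C 2) (double+1 a)) ⟩
    w + (b + d) + w + (b + d) * ((2 * A + 1) C 2) + b * (4 * A + 3) ∎
    where
    open ≡-Reasoning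
    regroup : ∀ a d b w X → w * 2 + (d * (1 + X) + b * (1 + (X + (4 * (1 + a) + 3)))) ≡
                            w + (b + d) + w + (b + d) * X + b * (4 * (1 + a) + 3)
    regroup = solve-∀
    double+1 : ∀ a → 1 + ((1 + a) + (1 + a)) ≡ 2 * (1 + a) + 1
    double+1 = solve-∀

minEdges-q≡r : ∀ {p q} → p < q → ∀ a₁ b₁ → q ≡ a₁ * p + b₁ → b₁ < p →
            MinEdgesAtMost p q q ((a₁ ^ 2 + 1) * p + (2 * a₁ + 1) * b₁)
minEdges-q≡r {p} p<q a₁ b₁ refl b₁<p
  with quotient-nonzero {p} {a₁} (<⇒≤ p<q) b₁<p | m≤n⇒∃[o]m+o≡n (<⇒≤ b₁<p)
... | a , refl | d , refl = bicliqueStar a d b₁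

minEdges-small-r : ∀ {p w k} → w + k < w + k + k → w + k + k + p ≤ 2 * (w + k) + 1 →
  ∀ a₂ b₂ → w ≡ a₂ * (p ∸ 1) + b₂ → b₂ < p ∸ 1 →
  MinEdgesAtMost p (w + k) (w + k + k) (a₂ ^ 2 * (p ∸ 1) + (2 * a₂ + 1) * b₂ + p + ((2 * k + 1) C 2))
minEdges-small-r {zero}               _   _    _  _  _    ()
minEdges-small-r {suc p′} {w} {zero}  q<r _    _  _  _    _ = ⊥-elim (<-irrefl (sym (+-identityʳ (w + 0))) q<r)
minEdges-small-r {suc p′} {w} {suc k} _   r+p≤ a₂ b₂ refl b₂<p′
  with quotient-nonzero {p′} {a₂} p′≤w b₂<p′ | m≤n⇒∃[o]m+o≡n (<⇒≤ b₂<p′)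
  where
  p′≤w : p′ ≤ w
  p′≤w = +-cancelˡ-≤ (w + suc k + suc k + 1) p′ w
           (subst₂ _≤_ (shiftˡ w k p′) (shiftʳ w k) r+p≤)
    where
    shiftˡ : ∀ w k p → w + (1 + k) + (1 + k) + (1 + p) ≡ w + (1 + k) + (1 + k) + 1 + p
    shiftˡ = solve-∀
    shiftʳ : ∀ w k → 2 * (w + (1 + k)) + 1 ≡ w + (1 + k) + (1 + k) + 1 + w
    shiftʳ = solve-∀
... | a , refl | d , refl = mixedStar a d b₂ k

minEdges-large-r : ∀ {p w k} → p < w + k → 2 * (w + k) + 1 < w + k + k + p →
  ∀ a₃ b₃ → k ≡ a₃ * (p ∸ w) + b₃ → b₃ < p ∸ w →
  MinEdgesAtMost p (w + k) (w + k + k) (p + w + (p ∸ w) * ((2 * a₃ + 1) C 2) + b₃ * (4 * a₃ + 3))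
minEdges-large-r {p} {w} {k} p<q 2q<r+p with m≤n⇒∃[o]m+o≡n w≤p
  where
  w≤p : w ≤ p
  w≤p = ≤-trans (n≤1+n w) (<⇒≤ (+-cancelˡ-< (w + k + k) (suc w) p
                                             (subst (_< w + k + k + p) (shift w k) 2q<r+p)))
    where
    shift : ∀ w k → 2 * (w + k) + 1 ≡ w + k + k + (1 + w)
    shift = solve-∀
... | M , refl rewrite m+n∸m≡n w M = construct p<q
  where
  construct : ∀ {k} → w + M < w + k → ∀ a₃ b₃ → k ≡ a₃ * M + b₃ → b₃ < M →
              MinEdgesAtMost (w + M) (w + k) (w + k + k) (w + M + w + M * ((2 * a₃ + 1) C 2) + b₃ * (4 * a₃ + 3))
  construct p<q a₃ b₃ refl b₃<M
    with quotient-nonzero {M} {a₃} (<⇒≤ (+-cancelˡ-< w M _ p<q)) b₃<M | m≤n⇒∃[o]m+o≡n (<⇒≤ b₃<M)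
  ... | a , refl | d , refl = coronaStar a d b₃ w

q≤r≤2q⇒q≡w+k×r≡w+k+k : ∀ {q r} → q ≤ r → r ≤ 2 * q → ∃₂ λ w k → q ≡ w + k × r ≡ w + k + k
q≤r≤2q⇒q≡w+k×r≡w+k+k {q} q≤r r≤2q with m≤n⇒∃[o]m+o≡n q≤r
... | k , refl
  with m≤n⇒∃[o]m+o≡n (+-cancelˡ-≤ q k q (subst (q + k ≤_) (cong (q +_) (+-identityʳ q)) r≤2q))
...   | w , refl = w , k , +-comm k w , cong (_+ k) (+-comm k w)

module _ (p w k : ℕ) where

  2q∸r≡w : 2 * (w + k) ∸ (w + k + k) ≡ w
  2q∸r≡w = trans (cong (_∸ (w + k + k)) (regroup w k)) (m+n∸n≡m w (w + k + k))
    where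
    regroup : ∀ w k → 2 * (w + k) ≡ w + (w + k + k)
    regroup = solve-∀

  r∸q≡k : w + k + k ∸ (w + k) ≡ k
  r∸q≡k = m+n∸m≡n (w + k) k

  p+r∸2q≡p∸w : p + (w + k + k) ∸ 2 * (w + k) ≡ p ∸ w
  p+r∸2q≡p∸w = trans (cong₂ _∸_ (regroupˡ p w k) (regroupʳ w k)) ([m+n]∸[m+o]≡n∸o (w + k + k) p w)
    where
    regroupˡ : ∀ p w k → p + (w + k + k) ≡ w + k + k + p
    regroupˡ = solve-∀
    regroupʳ : ∀ w k → 2 * (w + k) ≡ w + k + k + w
    regroupʳ = solve-∀

  p+2q∸r≡p+w : p + 2 * (w + k) ∸ (w + k + k) ≡ p + w
  p+2q∸r≡p+w = trans (cong (_∸ (w + k + k)) (regroup p w k)) (m+n∸n≡m (p + w) (w + k + k))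
    where
    regroup : ∀ p w k → p + 2 * (w + k) ≡ p + w + (w + k + k)
    regroup = solve-∀

theorem3p4 : ∀ (p q r : ℕ) → 2 ≤ p → p < q → q ≤ r → r ≤ 2 * q →
    (∀ (a₁ b₁ : ℕ) → q ≡ a₁ * p + b₁ → b₁ < p →
       MinEdgesAtMost p q q ((a₁ ^ 2 + 1) * p + (2 * a₁ + 1) * b₁))
    ×
    (q < r → r + p ≤ 2 * q + 1 →
       ∀ (a₂ b₂ : ℕ) → 2 * q ∸ r ≡ a₂ * (p ∸ 1) + b₂ → b₂ < p ∸ 1 →
       MinEdgesAtMost p q r
         (a₂ ^ 2 * (p ∸ 1) + (2 * a₂ + 1) * b₂ + p + ((2 * (r ∸ q) + 1) C 2)))
    ×
    (2 * q + 1 < r + p →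
       ∀ (a₃ b₃ : ℕ) → r ∸ q ≡ a₃ * (p + r ∸ 2 * q) + b₃ → b₃ < p + r ∸ 2 * q →
       MinEdgesAtMost p q r
         (p + 2 * q ∸ r + (p + r ∸ 2 * q) * ((2 * a₃ + 1) C 2) + b₃ * (4 * a₃ + 3)))
-- The constructions work for every p ≥ 1.
theorem3p4 p q r _ p<q q≤r r≤2q with q≤r≤2q⇒q≡w+k×r≡w+k+k q≤r r≤2q
... | w , k , refl , refl
  rewrite 2q∸r≡w p w k | r∸q≡k p w k | p+r∸2q≡p∸w p w k | p+2q∸r≡p+w p w k =
  minEdges-q≡r p<q , minEdges-small-r , minEdges-large-r p<q
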